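{- For every $p\ge1$, $B_{2p-1}(-1)=0$ and $(-1)^pB_{2p}(-1)=|\mathcal T_{2p}|$.
   Context: $\mathfrak S_n$ is the symmetric group on $[n]=\{1,\dots,n\}$. $B_n(t)=\sum_{\sigma}t^{|\{k:\sigma(k)>k\}|}$, the sum over permutations $\sigma\in\mathfrak S_n$ without fixed points. $\mathcal T_n$ (alternating permutations) is the set of $\sigma\in\mathfrak S_n$ with $\sigma(2j)<\sigma(2j-1)$ and $\sigma(2j)<\sigma(2j+1)$ for all $j$ with $2\le 2j\le n-1$, and additionally $\sigma(n)<\sigma(n-1)$ if $n$ is even. -}

module Defs where

open import Data.Nat using (ℕ; zero; suc; _+_; _*_; _<ᵇ_; _≡ᵇ_)
open import Data.Nat.Properties using ()
open import Data.Bool using (Bool; true; false; _∧_; _∨_; not; if_then_else_)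
open import Data.Fin using (Fin; toℕ)
open import Data.Vec using (Vec; []; _∷_; lookup)
open import Data.List using (List; []; _∷_; map; concatMap; allFin; filterᵇ; length)
open import Data.Integer using (ℤ; +_; -_) renaming (_+_ to _+ℤ_)

all : {A : Set} → (A → Bool) → List A → Bool
all p []       = true
all p (x ∷ xs) = p x ∧ all p xs

-- All maps [n] → [m], each encoded as the vector of its values (position i ↦ value).
-- Indices are 0-based: Fin n stands for [n] = {1,…,n} via i ↦ toℕ i + 1.
allMaps : (n m : ℕ) → List (Vec (Fin m) n)
allMaps zero    m = [] ∷ []
allMaps (suc n) m = concatMap (λ x → map (x ∷_) (allMaps n m)) (allFin m)

isInjective : {n : ℕ} → Vec (Fin n) n → Bool
isInjective {n} σ =
  all (λ i → all (λ j → (toℕ i ≡ᵇ toℕ j) ∨ not (toℕ (lookup σ i) ≡ᵇ toℕ (lookup σ j)))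
                 (allFin n))
      (allFin n)

Sym : (n : ℕ) → List (Vec (Fin n) n)
Sym n = filterᵇ isInjective (allMaps n n)

fixedPointFree : {n : ℕ} → Vec (Fin n) n → Bool
fixedPointFree {n} σ = all (λ k → not (toℕ (lookup σ k) ≡ᵇ toℕ k)) (allFin n)

exc : {n : ℕ} → Vec (Fin n) n → ℕ
exc {n} σ = length (filterᵇ (λ k → toℕ k <ᵇ toℕ (lookup σ k)) (allFin n))

negOnePow : ℕ → ℤ
negOnePow zero    = + 1
negOnePow (suc e) = - negOnePow e

sumℤ : List ℤ → ℤ
sumℤ []       = + 0
sumℤ (x ∷ xs) = x +ℤ sumℤ xs

B-at-minus-one : ℕ → ℤ
B-at-minus-one n = sumℤ (map (λ σ → negOnePow (exc σ)) (filterᵇ fixedPointFree (Sym n)))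

-- alternating condition (1-based positions translated to 0-based indices i = pos - 1):
-- for every 1-based even position 2j ≤ n: σ(2j) < σ(2j-1), and, if 2j+1 ≤ n, σ(2j) < σ(2j+1).
-- (For n even the last position 2j = n only has the left condition, as in the definition.)
isAlternating : {n : ℕ} → Vec (Fin n) n → Bool
isAlternating {n} σ = all cond (allFin n)
  where
  val : ℕ → ℕ   -- 0-based value of σ at 0-based index (only used at valid indices)
  val k = go k (allFin n)
    where
    go : ℕ → List (Fin n) → ℕ
    go k []       = 0
    go k (i ∷ is) = if toℕ i ≡ᵇ k then toℕ (lookup σ i) else go k is
  isOdd : ℕ → Bool
  isOdd zero          = false
  isOdd (suc zero)    = true
  isOdd (suc (suc k)) = isOdd k
  cond : Fin n → Bool
  cond i with toℕ i
  ... | zero  = true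
  ... | suc m = if isOdd (suc m)
                  then ((val (suc m) <ᵇ val m)
                        ∧ (if suc (suc m) <ᵇ n then val (suc m) <ᵇ val (suc (suc m)) else true))
                  else true

Alt : (n : ℕ) → List (Vec (Fin n) n)
Alt n = filterᵇ isAlternating (Sym n)

{-# OPTIONS --with-K #-}

-- B_n(-1) is evaluated by a sign-reversing involution on derangements (cyclic valley hopping).
-- Call x a cyclic double if σ⁻¹ x < x < σ x or σ⁻¹ x > x > σ x. Moving the least cyclic double x
-- along its cycle to the nearest place where its two neighbours have the opposite order changes
-- the number of excedances by one and the type of no other element, so only the derangements in
-- which every element is a cyclic peak or a cyclic valley survive.
-- Foata's fundamental transformation, which reads the blocks of a word cut before its
-- left-to-right maxima as cycles, maps the alternating permutations of [n] bijectively onto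
-- these peak-valley derangements when n is even; for odd n there are none. On each cycle of a
-- peak-valley derangement peaks and valleys alternate, so exactly n/2 elements are excedances
-- and every survivor contributes (-1)^(n/2).

module Submission where

open import Defs
open import Data.Nat using (ℕ; zero; suc; _+_; _*_)
import Data.Nat as ℕ
import Data.Nat.Properties as ℕ
open import Data.Integer using (ℤ; +_; -_) renaming (_+_ to _+ℤ_; _*_ to _*ℤ_)
import Data.Integer.Properties as ℤ
open import Algebra.Properties.CommutativeSemigroup ℤ.+-commutativeSemigroup
  using () renaming (interchange to +ℤ-interchange)
open import Data.Bool using (Bool; true; false; _∧_; not; if_then_else_; T; _xor_)
open import Data.List using (List; []; _∷_; map; length; filter; filterᵇ; allFin; concatMap)
open import Data.Fin as Fin using (Fin; toℕ; fromℕ<)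
import Data.Fin.Properties as Fin
open import Data.Vec as Vec using (Vec; lookup; tabulate)
import Data.Vec.Properties as Vec
open import Data.Maybe as Maybe using (Maybe; just; nothing; maybe′; is-nothing)
open import Data.Sum using (_⊎_; inj₁; inj₂)
import Data.Bool.Properties as Bool
open import Data.List.Membership.Propositional using (_∈_; _∉_; find)
open import Data.List.Membership.Propositional.Properties
  using (∈-filter⁺; ∈-filter⁻; ∈-map⁺; ∈-map⁻; ∈-allFin; ∈-++⁺ˡ; ∈-++⁺ʳ; ∈-concatMap⁻)
open import Data.List.Membership.Propositional.Properties.WithK using (unique∧set⇒bag)
open import Data.List.Relation.Binary.BagAndSetEquality using (∼bag⇒↭)
open import Data.List.Relation.Binary.Permutation.Propositional as ↭ using (_↭_)
import Data.List.Relation.Binary.Permutation.Propositional.Properties as ↭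
open import Data.List.Relation.Binary.Subset.Propositional using (_⊆_)
open import Data.List.Relation.Unary.All as All using (All; []; _∷_)
import Data.List.Relation.Unary.Any as Any
open import Data.List.Relation.Unary.Any using (here; there)
open import Data.List.Relation.Unary.Unique.Propositional using (Unique; []; _∷_)
import Data.List.Relation.Unary.Unique.Propositional.Properties as Unique
import Data.List.Properties as List
open import Data.Product using (∃-syntax; _×_; _,_; proj₁; proj₂)
open import Data.Empty using (⊥; ⊥-elim)
open import Function using (_∘_; _⇔_; mk⇔; Equivalence)
open Equivalence using (to; from)
open import Relation.Nullary using (¬_; yes; no; ¬?; contradiction)
open import Relation.Binary.Definitions using (DecidableEquality; tri<; tri≈; tri>)
open import Relation.Binary.PropositionalEquality
  using (_≡_; _≢_; refl; sym; trans; cong; cong₂; subst; module ≡-Reasoning)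

module _ {A : Set} where

  InjectiveOn : {B : Set} → List A → (A → B) → Set
  InjectiveOn xs f = ∀ {x y} → x ∈ xs → y ∈ xs → f x ≡ f y → x ≡ y

  map⁺-injectiveOn : {B : Set} {f : A → B} {xs : List A} →
    InjectiveOn xs f → Unique xs → Unique (map f xs)
  map⁺-injectiveOn {xs = []}     inj []       = []
  map⁺-injectiveOn {f = f} {xs = x ∷ xs} inj (x∉xs ∷ u) =
    fresh xs (λ y∈ → inj (here refl) (there y∈)) x∉xs
      ∷ map⁺-injectiveOn (λ y∈ z∈ → inj (there y∈) (there z∈)) u
    where
    fresh : ∀ ys → (∀ {y} → y ∈ ys → f x ≡ f y → x ≡ y) → All (x ≢_) ys → All (f x ≢_) (map f ys)
    fresh []       _   []         = []
    fresh (y ∷ ys) inj (x≢y ∷ ps) =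
      (λ e → x≢y (inj (here refl) e)) ∷ fresh ys (inj ∘ there) ps

  ↭-by-members : {xs ys : List A} → Unique xs → Unique ys → xs ⊆ ys → ys ⊆ xs → xs ↭ ys
  ↭-by-members ux uy xs⊆ys ys⊆xs = ∼bag⇒↭ (unique∧set⇒bag ux uy (mk⇔ xs⊆ys ys⊆xs))

  sumℤ-map-cong : {f g : A → ℤ} (xs : List A) → (∀ {x} → x ∈ xs → f x ≡ g x) →
    sumℤ (map f xs) ≡ sumℤ (map g xs)
  sumℤ-map-cong []       _  = refl
  sumℤ-map-cong (x ∷ xs) eq = cong₂ _+ℤ_ (eq (here refl)) (sumℤ-map-cong xs (eq ∘ there))

  sumℤ-map-+ : (f g : A → ℤ) (xs : List A) →
    sumℤ (map (λ x → f x +ℤ g x) xs) ≡ sumℤ (map f xs) +ℤ sumℤ (map g xs)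
  sumℤ-map-+ f g []       = refl
  sumℤ-map-+ f g (x ∷ xs) = begin
    (f x +ℤ g x) +ℤ sumℤ (map (λ x → f x +ℤ g x) xs)   ≡⟨ cong ((f x +ℤ g x) +ℤ_) (sumℤ-map-+ f g xs) ⟩
    (f x +ℤ g x) +ℤ (sumℤ (map f xs) +ℤ sumℤ (map g xs)) ≡⟨ +ℤ-interchange (f x) (g x) _ _ ⟩
    (f x +ℤ sumℤ (map f xs)) +ℤ (g x +ℤ sumℤ (map g xs)) ∎
    where open ≡-Reasoning

  sumℤ-map-filterᵇ : (p : A → Bool) (f : A → ℤ) (xs : List A) →
    sumℤ (map f (filterᵇ p xs)) ≡ sumℤ (map (λ x → if p x then f x else + 0) xs)
  sumℤ-map-filterᵇ p f []       = refl
  sumℤ-map-filterᵇ p f (x ∷ xs) with p x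
  ... | true  = cong (f x +ℤ_) (sumℤ-map-filterᵇ p f xs)
  ... | false = trans (sumℤ-map-filterᵇ p f xs) (sym (ℤ.+-identityˡ _))

  sumℤ-map-const : (c : ℤ) (xs : List A) → sumℤ (map (λ _ → c) xs) ≡ + length xs *ℤ c
  sumℤ-map-const c []       = sym (ℤ.*-zeroˡ c)
  sumℤ-map-const c (x ∷ xs) = begin
    c +ℤ sumℤ (map (λ _ → c) xs) ≡⟨ cong₂ _+ℤ_ (sym (ℤ.*-identityˡ c)) (sumℤ-map-const c xs) ⟩
    + 1 *ℤ c +ℤ + length xs *ℤ c ≡⟨ ℤ.*-distribʳ-+ c (+ 1) (+ length xs) ⟨
    + suc (length xs) *ℤ c ∎
    where open ≡-Reasoning

sumℤ-↭ : {xs ys : List ℤ} → xs ↭ ys → sumℤ xs ≡ sumℤ ys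
sumℤ-↭ ↭.refl          = refl
sumℤ-↭ (↭.prep x p)    = cong (x +ℤ_) (sumℤ-↭ p)
sumℤ-↭ (↭.swap {xs} {ys} x y p) = begin
  x +ℤ (y +ℤ sumℤ xs) ≡⟨ ℤ.+-assoc x y (sumℤ xs) ⟨
  (x +ℤ y) +ℤ sumℤ xs ≡⟨ cong₂ _+ℤ_ (ℤ.+-comm x y) (sumℤ-↭ p) ⟩
  (y +ℤ x) +ℤ sumℤ ys ≡⟨ ℤ.+-assoc y x (sumℤ ys) ⟩
  y +ℤ (x +ℤ sumℤ ys) ∎
  where open ≡-Reasoning
sumℤ-↭ (↭.trans p q)   = trans (sumℤ-↭ p) (sumℤ-↭ q)

sumℤ-reindex : {A B : Set} (h : B → ℤ) (φ : A → B) {xs : List A} {ys : List B} →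
  Unique xs → Unique ys → InjectiveOn xs φ →
  (∀ {x} → x ∈ xs → φ x ∈ ys) → (∀ {y} → y ∈ ys → ∃[ x ] x ∈ xs × y ≡ φ x) →
  sumℤ (map h ys) ≡ sumℤ (map (h ∘ φ) xs)
sumℤ-reindex h φ {xs} {ys} ux uy inj into onto = begin
  sumℤ (map h ys)         ≡⟨ sumℤ-↭ (↭.map⁺ h (↭-by-members uy (map⁺-injectiveOn inj ux) ys⊆φxs φxs⊆ys)) ⟩
  sumℤ (map h (map φ xs)) ≡⟨ cong sumℤ (List.map-∘ xs) ⟨
  sumℤ (map (h ∘ φ) xs)   ∎
  where
  open ≡-Reasoning
  φxs⊆ys : map φ xs ⊆ ys
  φxs⊆ys y∈ with _ , x∈ , refl ← ∈-map⁻ φ y∈ = into x∈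
  ys⊆φxs : ys ⊆ map φ xs
  ys⊆φxs y∈ with _ , x∈ , refl ← onto y∈ = ∈-map⁺ φ x∈

sumℤ-signReversingInvolution : {A : Set} (h : A → ℤ) (ι : A → A) (fixed : A → Bool) {xs : List A} →
  Unique xs → (∀ {x} → x ∈ xs → ι x ∈ xs) → (∀ {x} → x ∈ xs → ι (ι x) ≡ x) →
  (∀ {x} → x ∈ xs → T (fixed x) → ι x ≡ x) →
  (∀ {x} → x ∈ xs → ¬ T (fixed x) → h (ι x) ≡ - h x) →
  sumℤ (map h xs) ≡ sumℤ (map h (filterᵇ fixed xs))
sumℤ-signReversingInvolution h ι fixed {xs} u closed invol fix flip =
  double-injective (begin
    S +ℤ S                                                     ≡⟨ cong (S +ℤ_) reindexed ⟩
    S +ℤ sumℤ (map (h ∘ ι) xs)                                 ≡⟨ sumℤ-map-+ h (h ∘ ι) xs ⟨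
    sumℤ (map (λ x → h x +ℤ h (ι x)) xs)                       ≡⟨ sumℤ-map-cong xs pair ⟩
    sumℤ (map (λ x → if fixed x then h x +ℤ h x else + 0) xs) ≡⟨ sumℤ-map-cong xs split ⟩
    sumℤ (map (λ x → hFixed x +ℤ hFixed x) xs)                ≡⟨ sumℤ-map-+ hFixed hFixed xs ⟩
    sumℤ (map hFixed xs) +ℤ sumℤ (map hFixed xs)               ≡⟨ cong₂ _+ℤ_ filtered filtered ⟨
    SFixed +ℤ SFixed                                           ∎)
  where
  open ≡-Reasoning
  S = sumℤ (map h xs)
  SFixed = sumℤ (map h (filterᵇ fixed xs))
  hFixed : _ → ℤ
  hFixed x = if fixed x then h x else + 0
  filtered = sumℤ-map-filterᵇ fixed h xs

  reindexed : S ≡ sumℤ (map (h ∘ ι) xs)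
  reindexed = sumℤ-reindex h ι u u (λ x∈ y∈ e → trans (sym (invol x∈)) (trans (cong ι e) (invol y∈)))
    closed (λ y∈ → ι _ , closed y∈ , sym (invol y∈))

  pair : ∀ {x} → x ∈ xs → h x +ℤ h (ι x) ≡ (if fixed x then h x +ℤ h x else + 0)
  pair {x} x∈ with fixed x in eq
  ... | true  = cong (λ y → h x +ℤ h y) (fix x∈ (subst T (sym eq) _))
  ... | false = trans (cong (h x +ℤ_) (flip x∈ (λ t → subst T eq t))) (ℤ.+-inverseʳ (h x))
  split : ∀ {x} → x ∈ xs → (if fixed x then h x +ℤ h x else + 0) ≡ hFixed x +ℤ hFixed x
  split {x} _ with fixed x
  ... | true  = refl
  ... | false = refl

  double-injective : ∀ {a b} → a +ℤ a ≡ b +ℤ b → a ≡ b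
  double-injective {a} {b} e = ℤ.*-cancelˡ-≡ (+ 2) a b (trans (2*≡+ a) (trans e (sym (2*≡+ b))))
    where
    2*≡+ : ∀ c → + 2 *ℤ c ≡ c +ℤ c
    2*≡+ c = trans (ℤ.*-distribʳ-+ c (+ 1) (+ 1)) (cong₂ _+ℤ_ (ℤ.*-identityˡ c) (ℤ.*-identityˡ c))

module _ {A : Set} (_≟_ : DecidableEquality A) where

  open import Data.List.Membership.DecPropositional _≟_ using (_∈?_)

  private
    without : A → List A → List A
    without x = filter (λ y → ¬? (x ≟ y))

    length-without-< : ∀ {x ys} → x ∈ ys → length (without x ys) ℕ.< length ys
    length-without-< x∈ = List.filter-notAll (λ y → ¬? (_ ≟ y)) _ (Any.map (λ e ne → ne e) x∈)

  length-mono-⊆ : {xs ys : List A} → Unique xs → xs ⊆ ys → length xs ℕ.≤ length ys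
  length-mono-⊆ {[]}     _            _  = ℕ.z≤n
  length-mono-⊆ {x ∷ xs} {ys} (x∉xs ∷ u) sub =
    ℕ.≤-trans (ℕ.s≤s (length-mono-⊆ u xs⊆ys-x)) (length-without-< (sub (here refl)))
    where
    xs⊆ys-x : xs ⊆ without x ys
    xs⊆ys-x z∈ = ∈-filter⁺ (λ y → ¬? (x ≟ y)) (sub (there z∈)) (All.lookup x∉xs z∈)

  ⊆-length⇒⊇ : {xs ys : List A} → Unique xs → xs ⊆ ys → length ys ℕ.≤ length xs → ys ⊆ xs
  ⊆-length⇒⊇ {xs} {ys} u sub ys≤xs {y} y∈ with y ∈? xs
  ... | yes y∈xs = y∈xs
  ... | no  y∉xs = contradiction ys≤xs (ℕ.<⇒≱ (ℕ.<-≤-trans (ℕ.s≤s xs≤ys-y) (length-without-< y∈)))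
    where
    xs≤ys-y : length xs ℕ.≤ length (without y ys)
    xs≤ys-y = length-mono-⊆ u (λ z∈ → ∈-filter⁺ (λ z → ¬? (y ≟ z)) (sub z∈) (λ { refl → y∉xs z∈ }))

module _ {A : Set} (p : A → Bool) where

  ∈-filterᵇ⁺ : {x : A} {xs : List A} → x ∈ xs → T (p x) → x ∈ filterᵇ p xs
  ∈-filterᵇ⁺ = ∈-filter⁺ (Bool.T? ∘ p)

  ∈-filterᵇ⁻ : {x : A} (xs : List A) → x ∈ filterᵇ p xs → x ∈ xs × T (p x)
  ∈-filterᵇ⁻ xs = ∈-filter⁻ (Bool.T? ∘ p) {xs = xs}

  filterᵇ-unique : {xs : List A} → Unique xs → Unique (filterᵇ p xs)
  filterᵇ-unique = Unique.filter⁺ (Bool.T? ∘ p)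

  T-all : (xs : List A) → T (all p xs) ⇔ (∀ {x} → x ∈ xs → T (p x))
  T-all []       = mk⇔ (λ _ ()) (λ _ → _)
  T-all (x ∷ xs) = mk⇔
    (λ t → let tx , txs = to Bool.T-∧ t in
      λ { (here refl) → tx ; (there x∈) → to (T-all xs) txs x∈ })
    (λ h → from Bool.T-∧ (h (here refl) , from (T-all xs) (λ x∈ → h (there x∈))))

module _ {A : Set} (p q : A → Bool) where

  length-filterᵇ-cong : {xs : List A} → (∀ {x} → x ∈ xs → p x ≡ q x) →
    length (filterᵇ p xs) ≡ length (filterᵇ q xs)
  length-filterᵇ-cong {[]}     _   = refl
  length-filterᵇ-cong {x ∷ xs} p≗q with p x | q x | p≗q (here refl)
  ... | true  | .true  | refl = cong suc (length-filterᵇ-cong (λ y∈ → p≗q (there y∈)))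
  ... | false | .false | refl = length-filterᵇ-cong (λ y∈ → p≗q (there y∈))

  length-filterᵇ-suc : {xs : List A} {x : A} → Unique xs → x ∈ xs → p x ≡ true → q x ≡ false →
    (∀ {y} → y ∈ xs → y ≢ x → p y ≡ q y) → length (filterᵇ p xs) ≡ suc (length (filterᵇ q xs))
  length-filterᵇ-suc {y ∷ ys} (y∉ys ∷ _) (here refl) px qx p≗q rewrite px | qx =
    cong suc (length-filterᵇ-cong λ z∈ → p≗q (there z∈) (λ { refl → All.lookup y∉ys z∈ refl }))
  length-filterᵇ-suc {y ∷ ys} (y∉ys ∷ u) (there x∈) px qx p≗q
    with p y | q y | p≗q (here refl) (λ { refl → All.lookup y∉ys x∈ refl })
  ... | true  | .true  | refl = cong suc (length-filterᵇ-suc u x∈ px qx (λ z∈ → p≗q (there z∈)))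
  ... | false | .false | refl = length-filterᵇ-suc u x∈ px qx (λ z∈ → p≗q (there z∈))

T-all-allFin : {n : ℕ} (p : Fin n → Bool) → T (all p (allFin n)) ⇔ (∀ i → T (p i))
T-all-allFin {n} p = mk⇔ (λ t i → to (T-all p (allFin n)) t (∈-allFin i))
                         (λ h → from (T-all p (allFin n)) (λ {i} _ → h i))

T-not : {b : Bool} → T (not b) ⇔ (¬ T b)
T-not {true}  = mk⇔ (λ ()) (λ ¬t → ¬t _)
T-not {false} = mk⇔ (λ _ ()) (λ _ → _)

T-toℕ-≡ᵇ : {n : ℕ} {i j : Fin n} → T (toℕ i ℕ.≡ᵇ toℕ j) ⇔ (i ≡ j)
T-toℕ-≡ᵇ {i = i} {j} = mk⇔ (Fin.toℕ-injective ∘ ℕ.≡ᵇ⇒≡ (toℕ i) (toℕ j))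
                            (ℕ.≡⇒≡ᵇ (toℕ i) (toℕ j) ∘ cong toℕ)

module ℕᵇ where

  <⇒≡true : {m n : ℕ} → m ℕ.< n → (m ℕ.<ᵇ n) ≡ true
  <⇒≡true m<n = to Bool.T-≡ (ℕ.<⇒<ᵇ m<n)

  ≮⇒≡false : {m n : ℕ} → ¬ m ℕ.< n → (m ℕ.<ᵇ n) ≡ false
  ≮⇒≡false {m} {n} m≮n = to Bool.T-not-≡ (from T-not (m≮n ∘ ℕ.<ᵇ⇒< m n))

  ≡true⇒< : {m n : ℕ} → (m ℕ.<ᵇ n) ≡ true → m ℕ.< n
  ≡true⇒< {m} {n} e = ℕ.<ᵇ⇒< m n (from Bool.T-≡ e)

  ≡false⇒≮ : {m n : ℕ} → (m ℕ.<ᵇ n) ≡ false → ¬ m ℕ.< n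
  ≡false⇒≮ e m<n = contradiction (trans (sym (<⇒≡true m<n)) e) λ ()

module _ {n : ℕ} where

  record IsPermutation (σ : Vec (Fin n) n) : Set where
    constructor lookup-injective⇒
    field lookup-injective : ∀ {i j} → lookup σ i ≡ lookup σ j → i ≡ j

  FixedPointFree : Vec (Fin n) n → Set
  FixedPointFree σ = ∀ i → lookup σ i ≢ i

  T-isInjective : (σ : Vec (Fin n) n) → T (isInjective σ) ⇔ IsPermutation σ
  T-isInjective σ = mk⇔
    (λ t → lookup-injective⇒ λ {i} {j} σi≡σj → case-≡ (to Bool.T-∨
      (to (T-all-allFin _) (to (T-all-allFin _) t i) j)) σi≡σj)
    (λ inj → from (T-all-allFin _) λ i → from (T-all-allFin _) λ j →
      from Bool.T-∨ (decide i j (IsPermutation.lookup-injective inj)))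
    where
    case-≡ : ∀ {i j} → T (toℕ i ℕ.≡ᵇ toℕ j) ⊎ T (not (toℕ (lookup σ i) ℕ.≡ᵇ toℕ (lookup σ j))) →
      lookup σ i ≡ lookup σ j → i ≡ j
    case-≡ (inj₁ t)  _ = to T-toℕ-≡ᵇ t
    case-≡ (inj₂ t) e = contradiction (from T-toℕ-≡ᵇ e) (to T-not t)
    decide : ∀ i j → (∀ {i j} → lookup σ i ≡ lookup σ j → i ≡ j) →
      T (toℕ i ℕ.≡ᵇ toℕ j) ⊎ T (not (toℕ (lookup σ i) ℕ.≡ᵇ toℕ (lookup σ j)))
    decide i j inj with i Fin.≟ j
    ... | yes i≡j = inj₁ (from T-toℕ-≡ᵇ i≡j)
    ... | no  i≢j = inj₂ (from T-not (i≢j ∘ inj ∘ to T-toℕ-≡ᵇ))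

  T-fixedPointFree : (σ : Vec (Fin n) n) → T (fixedPointFree σ) ⇔ FixedPointFree σ
  T-fixedPointFree σ = mk⇔
    (λ t i → to T-not (to (T-all-allFin _) t i) ∘ from T-toℕ-≡ᵇ)
    (λ fpf → from (T-all-allFin _) λ i →
      from T-not (fpf i ∘ to T-toℕ-≡ᵇ))

∈-allMaps : (n m : ℕ) (v : Vec (Fin m) n) → v ∈ allMaps n m
∈-allMaps zero    m Vec.[]       = here refl
∈-allMaps (suc n) m (x Vec.∷ v) = ∈-concat (allFin m) (∈-allFin x)
  where
  ∈-concat : ∀ xs → x ∈ xs → (x Vec.∷ v) ∈ concatMap (λ z → map (z Vec.∷_) (allMaps n m)) xs
  ∈-concat (y ∷ xs) (here refl) = ∈-++⁺ˡ (∈-map⁺ (x Vec.∷_) (∈-allMaps n m v))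
  ∈-concat (y ∷ xs) (there x∈)  = ∈-++⁺ʳ (map (y Vec.∷_) (allMaps n m)) (∈-concat xs x∈)

allMaps-unique : (n m : ℕ) → Unique (allMaps n m)
allMaps-unique zero    m = [] ∷ []
allMaps-unique (suc n) m = concat-unique (allFin m) (Unique.allFin⁺ m)
  where
  block : Fin m → List (Vec (Fin m) (suc n))
  block z = map (z Vec.∷_) (allMaps n m)
  head-∈-block : ∀ {z v} → v ∈ block z → Vec.head v ≡ z
  head-∈-block v∈ with _ , _ , refl ← ∈-map⁻ _ v∈ = refl
  concat-unique : ∀ zs → Unique zs → Unique (concatMap block zs)
  concat-unique []       _          = []
  concat-unique (z ∷ zs) (z∉zs ∷ u) = Unique.++⁺
    (Unique.map⁺ Vec.∷-injectiveʳ (allMaps-unique n m)) (concat-unique zs u) disjoint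
    where
    disjoint : ∀ {v} → ¬ (v ∈ block z × v ∈ concatMap block zs)
    disjoint (v∈z , v∈zs) with z′ , z′∈ , v∈z′ ← find (∈-concatMap⁻ block {xs = zs} v∈zs) =
      All.lookup z∉zs z′∈ (trans (sym (head-∈-block v∈z)) (head-∈-block v∈z′))

module _ {n : ℕ} where

  ∈-Sym⁺ : {σ : Vec (Fin n) n} → IsPermutation σ → σ ∈ Sym n
  ∈-Sym⁺ {σ} perm = ∈-filterᵇ⁺ isInjective (∈-allMaps n n σ) (from (T-isInjective σ) perm)

  ∈-Sym⁻ : {σ : Vec (Fin n) n} → σ ∈ Sym n → IsPermutation σ
  ∈-Sym⁻ {σ} σ∈ = to (T-isInjective σ) (proj₂ (∈-filterᵇ⁻ isInjective (allMaps n n) σ∈))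

  Sym-unique : Unique (Sym n)
  Sym-unique = filterᵇ-unique isInjective (allMaps-unique n n)

Derangements : (n : ℕ) → List (Vec (Fin n) n)
Derangements n = filterᵇ fixedPointFree (Sym n)

module _ {n : ℕ} where

  ∈-Derangements⁺ : {σ : Vec (Fin n) n} → IsPermutation σ → FixedPointFree σ → σ ∈ Derangements n
  ∈-Derangements⁺ {σ} perm fpf = ∈-filterᵇ⁺ fixedPointFree (∈-Sym⁺ perm) (from (T-fixedPointFree σ) fpf)

  ∈-Derangements⁻ : {σ : Vec (Fin n) n} → σ ∈ Derangements n → IsPermutation σ × FixedPointFree σ
  ∈-Derangements⁻ {σ} σ∈ = let σ∈Sym , t = ∈-filterᵇ⁻ fixedPointFree (Sym n) σ∈ in
    ∈-Sym⁻ σ∈Sym , to (T-fixedPointFree σ) t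

  Derangements-unique : Unique (Derangements n)
  Derangements-unique = filterᵇ-unique fixedPointFree Sym-unique

injective⇒surjective : {n : ℕ} (f : Fin n → Fin n) → (∀ {i j} → f i ≡ f j → i ≡ j) →
  ∀ y → ∃[ i ] f i ≡ y
injective⇒surjective {suc n} f inj y with Fin.any? (λ i → f i Fin.≟ y)
... | yes hit = hit
... | no miss = contradiction (Fin.injective⇒≤ punched-injective) (ℕ.<-irrefl refl)
  where
  y≢f : ∀ i → y ≢ f i
  y≢f i e = miss (i , sym e)
  punched : Fin (suc n) → Fin n
  punched i = Fin.punchOut (y≢f i)
  punched-injective : ∀ {i j} → punched i ≡ punched j → i ≡ j
  punched-injective {i} {j} e = inj (Fin.punchOut-injective (y≢f i) (y≢f j) e)

inverse : {n : ℕ} → Vec (Fin n) n → Fin n → Fin n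
inverse σ y with Fin.any? (λ i → lookup σ i Fin.≟ y)
... | yes (i , _) = i
... | no  _       = y

module _ {n : ℕ} {σ : Vec (Fin n) n} (perm : IsPermutation σ) where

  lookup-inverse : ∀ y → lookup σ (inverse σ y) ≡ y
  lookup-inverse y with Fin.any? (λ i → lookup σ i Fin.≟ y)
  ... | yes (_ , σi≡y) = σi≡y
  ... | no  miss       = contradiction (injective⇒surjective (lookup σ) (IsPermutation.lookup-injective perm) y) miss

  inverse-lookup : ∀ i → inverse σ (lookup σ i) ≡ i
  inverse-lookup i = IsPermutation.lookup-injective perm (lookup-inverse (lookup σ i))

  inverse-unique : (g : Fin n → Fin n) → (∀ y → lookup σ (g y) ≡ y) → ∀ y → inverse σ y ≡ g y
  inverse-unique g σ∘g y = IsPermutation.lookup-injective perm (trans (lookup-inverse y) (sym (σ∘g y)))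

findFirst : {n : ℕ} → (Fin n → Bool) → Maybe (Fin n)
findFirst {zero}  p = nothing
findFirst {suc n} p with p Fin.zero
... | true  = just Fin.zero
... | false = Maybe.map Fin.suc (findFirst (p ∘ Fin.suc))

findFirst-nothing : {n : ℕ} (p : Fin n → Bool) → findFirst p ≡ nothing → ∀ i → p i ≡ false
findFirst-nothing {suc n} p e i with p Fin.zero in p0
findFirst-nothing {suc n} p () i | true
findFirst-nothing {suc n} p e i | false with findFirst (p ∘ Fin.suc) in e′ | i
... | nothing | Fin.zero  = p0
... | nothing | Fin.suc i = findFirst-nothing (p ∘ Fin.suc) e′ i

findFirst-just : {n : ℕ} (p : Fin n → Bool) {x : Fin n} → findFirst p ≡ just x →
  p x ≡ true × (∀ i → i Fin.< x → p i ≡ false)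
findFirst-just {suc n} p e with p Fin.zero in p0
findFirst-just {suc n} p refl | true = p0 , λ _ ()
findFirst-just {suc n} p e | false with findFirst (p ∘ Fin.suc) in e′
findFirst-just {suc n} p refl | false | just y = proj₁ rest , earlier
  where
  rest = findFirst-just (p ∘ Fin.suc) e′
  earlier : ∀ i → i Fin.< Fin.suc y → p i ≡ false
  earlier Fin.zero    _           = p0
  earlier (Fin.suc i) (ℕ.s≤s i<y) = proj₂ rest i i<y

findFirst-least : {n : ℕ} (p : Fin n → Bool) (x : Fin n) → p x ≡ true → (∀ i → i Fin.< x → p i ≡ false) →
  findFirst p ≡ just x
findFirst-least {suc n} p Fin.zero px _ with p Fin.zero
... | true = refl
findFirst-least {suc n} p Fin.zero () _ | false
findFirst-least {suc n} p (Fin.suc x) px earlier with p Fin.zero in p0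
... | true  = contradiction (trans (sym p0) (earlier Fin.zero ℕ.z<s)) λ ()
... | false rewrite findFirst-least (p ∘ Fin.suc) x px (λ i i<x → earlier (Fin.suc i) (ℕ.s≤s i<x)) = refl

findFirst-cong : {n : ℕ} {p q : Fin n → Bool} → (∀ i → p i ≡ q i) → findFirst p ≡ findFirst q
findFirst-cong {zero}          _   = refl
findFirst-cong {suc n} {p} {q} p≗q with p Fin.zero | q Fin.zero | p≗q Fin.zero
... | true  | .true  | refl = refl
... | false | .false | refl = cong (Maybe.map Fin.suc) (findFirst-cong (p≗q ∘ Fin.suc))

module _ {A : Set} (f : A → A) where

  iterate : ℕ → A → A
  iterate zero    y = y
  iterate (suc k) y = f (iterate k y)

  iterate-suc′ : ∀ k y → iterate (suc k) y ≡ iterate k (f y)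
  iterate-suc′ zero    y = refl
  iterate-suc′ (suc k) y = cong f (iterate-suc′ k y)

  iterate-+ : ∀ k l y → iterate (k + l) y ≡ iterate k (iterate l y)
  iterate-+ zero    l y = refl
  iterate-+ (suc k) l y = cong f (iterate-+ k l y)

  iterate-injective : (∀ {y z} → f y ≡ f z → y ≡ z) → ∀ k {y z} → iterate k y ≡ iterate k z → y ≡ z
  iterate-injective inj zero    e = e
  iterate-injective inj (suc k) e = iterate-injective inj k (inj e)

iterate-cong : {A : Set} {f g : A → A} → (∀ y → f y ≡ g y) → ∀ k y → iterate f k y ≡ iterate g k y
iterate-cong f≗g zero    y = refl
iterate-cong {g = g} f≗g (suc k) y = trans (f≗g _) (cong g (iterate-cong f≗g k y))

iterate-periodic : {n : ℕ} (f : Fin n → Fin n) → (∀ {y z} → f y ≡ f z → y ≡ z) →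
  ∀ x → ∃[ m ] 1 ℕ.≤ m × m ℕ.≤ n × iterate f m x ≡ x
iterate-periodic {n} f inj x
  with i , j , i<j , fⁱx≡fʲx ← Fin.pigeonhole (ℕ.n<1+n n) (λ i → iterate f (toℕ i) x) =
  m , ℕ.m<n⇒0<n∸m i<j , m≤n , iterate-injective f inj (toℕ i) (begin
    iterate f (toℕ i) (iterate f m x) ≡⟨ iterate-+ f (toℕ i) m x ⟨
    iterate f (toℕ i + m) x          ≡⟨ cong (λ k → iterate f k x) (ℕ.m+[n∸m]≡n (ℕ.<⇒≤ i<j)) ⟩
    iterate f (toℕ j) x              ≡⟨ fⁱx≡fʲx ⟨
    iterate f (toℕ i) x              ∎)
  where
  open ≡-Reasoning
  m = toℕ j ℕ.∸ toℕ i
  m≤n : m ℕ.≤ n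
  m≤n = ℕ.≤-trans (ℕ.m∸n≤m (toℕ j) (toℕ i)) (ℕ.s≤s⁻¹ (Fin.toℕ<n j))

module _ {n : ℕ} where

  infixl 5 _[_↦_]

  -- Opaque, so that goals show h [ p ↦ q ] rather than the case split on y ≟ p.
  opaque
    _[_↦_] : (Fin n → Fin n) → Fin n → Fin n → Fin n → Fin n
    (h [ p ↦ q ]) y with y Fin.≟ p
    ... | yes _ = q
    ... | no  _ = h y

    [↦]-here : (h : Fin n → Fin n) (p q : Fin n) → (h [ p ↦ q ]) p ≡ q
    [↦]-here h p q with p Fin.≟ p
    ... | yes _   = refl
    ... | no  p≢p = contradiction refl p≢p

    [↦]-there : (h : Fin n → Fin n) {p q y : Fin n} → y ≢ p → (h [ p ↦ q ]) y ≡ h y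
    [↦]-there h {p} {y = y} y≢p with y Fin.≟ p
    ... | yes y≡p = contradiction y≡p y≢p
    ... | no  _   = refl

    [↦]-cong : {h h′ : Fin n → Fin n} → (∀ y → h y ≡ h′ y) → ∀ {p q p′ q′} → p ≡ p′ → q ≡ q′ →
      ∀ y → (h [ p ↦ q ]) y ≡ (h′ [ p′ ↦ q′ ]) y
    [↦]-cong h≗h′ {p} refl refl y with y Fin.≟ p
    ... | yes _ = refl
    ... | no  _ = h≗h′ y

-- Cyclic valley hopping

module _ {n : ℕ} where

  infix 4 _<ᵇ_
  _<ᵇ_ : Fin n → Fin n → Bool
  i <ᵇ j = toℕ i ℕ.<ᵇ toℕ j

  <⇒<ᵇ : {i j : Fin n} → i Fin.< j → (i <ᵇ j) ≡ true
  <⇒<ᵇ = ℕᵇ.<⇒≡true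

  >⇒<ᵇ : {i j : Fin n} → j Fin.< i → (i <ᵇ j) ≡ false
  >⇒<ᵇ j<i = ℕᵇ.≮⇒≡false (ℕ.<-asym j<i)

  <ᵇ⇒< : {i j : Fin n} → (i <ᵇ j) ≡ true → i Fin.< j
  <ᵇ⇒< = ℕᵇ.≡true⇒<

  ≮∧≢⇒> : {i j : Fin n} → ¬ (i Fin.< j) → i ≢ j → j Fin.< i
  ≮∧≢⇒> i≮j i≢j = Fin.≤∧≢⇒< (ℕ.≮⇒≥ i≮j) (i≢j ∘ sym)

  <ᵇ-flip : {i j : Fin n} → i ≢ j → (i <ᵇ j) ≡ not (j <ᵇ i)
  <ᵇ-flip {i} {j} i≢j with Fin.<-cmp i j
  ... | tri< i<j _ _ = trans (<⇒<ᵇ i<j) (cong not (sym (>⇒<ᵇ i<j)))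
  ... | tri≈ _ i≡j _ = contradiction i≡j i≢j
  ... | tri> _ _ j<i = trans (>⇒<ᵇ j<i) (cong not (sym (<⇒<ᵇ j<i)))

  ≢ᵇ⇒< : {i j : Fin n} → (i <ᵇ j) ≡ false → i ≢ j → j Fin.< i
  ≢ᵇ⇒< {i} {j} e = ≮∧≢⇒> (λ i<j → contradiction (trans (sym (<⇒<ᵇ i<j)) e) λ ())

  excᶠ : (Fin n → Fin n) → ℕ
  excᶠ h = length (filterᵇ (λ k → k <ᵇ h k) (allFin n))

  isCyclicDouble : (Fin n → Fin n) → (Fin n → Fin n) → Fin n → Bool
  isCyclicDouble f g y = (g y <ᵇ y) xor (f y <ᵇ y)

  returnsBelow : (Fin n → Fin n) → Fin n → Fin n → Bool
  returnsBelow f x t = f (iterate f (suc (toℕ t)) x) <ᵇ x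

  hopTarget : (Fin n → Fin n) → Fin n → Fin n
  hopTarget f x = maybe′ (λ t → iterate f (suc (toℕ t)) x) x (findFirst (returnsBelow f x))

  -- For g x < x < f x on a cycle of the derangement f (with inverse g), x is cut out of its
  -- cycle and reinserted just after a = hopTarget f x, the first element after x whose
  -- successor lies below x; there x becomes a double descent.
  hopForward hopBackward : (Fin n → Fin n) → (Fin n → Fin n) → Fin n → Fin n → Fin n
  hopForward  f g x = f [ hopTarget f x ↦ x ] [ x ↦ f (hopTarget f x) ] [ g x ↦ f x ]
  hopBackward f g x = g [ x ↦ hopTarget f x ] [ f (hopTarget f x) ↦ x ] [ f x ↦ g x ]

  hopTarget-cong : {f f′ : Fin n → Fin n} → (∀ y → f y ≡ f′ y) → ∀ x → hopTarget f x ≡ hopTarget f′ x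
  hopTarget-cong {f} {f′} f≗f′ x
    with findFirst (returnsBelow f x) | findFirst (returnsBelow f′ x)
       | findFirst-cong {p = returnsBelow f x} {q = returnsBelow f′ x}
           (λ t → cong (_<ᵇ x) (iterate-cong f≗f′ (suc (suc (toℕ t))) x))
  ... | just t  | .(just t) | refl = iterate-cong f≗f′ (suc (toℕ t)) x
  ... | nothing | .nothing  | refl = refl

  module _ {f g f′ g′ : Fin n → Fin n} (f≗f′ : ∀ y → f y ≡ f′ y) (g≗g′ : ∀ y → g y ≡ g′ y) (x : Fin n) where

    private
      target≡ = hopTarget-cong f≗f′ x

    hopForward-cong : ∀ y → hopForward f g x y ≡ hopForward f′ g′ x y
    hopForward-cong = [↦]-cong ([↦]-cong ([↦]-cong f≗f′ target≡ refl) refl (trans (f≗f′ _) (cong f′ target≡)))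
                               (g≗g′ x) (f≗f′ x)

    hopBackward-cong : ∀ y → hopBackward f g x y ≡ hopBackward f′ g′ x y
    hopBackward-cong = [↦]-cong ([↦]-cong ([↦]-cong g≗g′ refl target≡) (trans (f≗f′ _) (cong f′ target≡)) refl)
                                (f≗f′ x) (g≗g′ x)

module DoubleAscentHop {n : ℕ} (f g : Fin n → Fin n)
    (f∘g : ∀ y → f (g y) ≡ y) (g∘f : ∀ y → g (f y) ≡ y) (f-fpf : ∀ y → f y ≢ y)
    (x : Fin n) (u<x : g x Fin.< x) (x<v : x Fin.< f x) where

  f-injective : ∀ {y z} → f y ≡ f z → y ≡ z
  f-injective {y} {z} e = trans (sym (g∘f y)) (trans (cong g e) (g∘f z))

  u v : Fin n
  u = g x
  v = f x

  cycle-reaches-u : ∃[ k ] k ℕ.< n × iterate f (2 + k) x ≡ u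
  cycle-reaches-u with iterate-periodic f f-injective x
  ... | 1 , _ , _ , fx≡x = contradiction fx≡x (f-fpf x)
  ... | 2 , _ , _ , ffx≡x = ⊥-elim (Fin.<-irrefl (sym (f-injective (trans ffx≡x (sym (f∘g x))))) (Fin.<-trans u<x x<v))
  ... | suc (suc (suc k)) , _ , 3+k≤n , f³⁺ᵏx≡x =
          k , ℕ.≤-<-trans (ℕ.m≤n+m k 2) 3+k≤n , f-injective (trans f³⁺ᵏx≡x (sym (f∘g x)))

  private
    first-return : ∃[ t ] findFirst (returnsBelow f x) ≡ just t
    first-return with findFirst (returnsBelow f x) in e
    ... | just t  = t , refl
    ... | nothing = contradiction (findFirst-nothing (returnsBelow f x) e (fromℕ< k<n)) λ below≡false →
                      contradiction (trans (sym below≡false) k-below) λ ()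
      where
      k = proj₁ cycle-reaches-u
      k<n = proj₁ (proj₂ cycle-reaches-u)
      k-below : returnsBelow f x (fromℕ< k<n) ≡ true
      k-below = <⇒<ᵇ (subst (Fin._< x)
        (sym (trans (cong (λ i → iterate f (2 + i) x) (Fin.toℕ-fromℕ< k<n)) (proj₂ (proj₂ cycle-reaches-u)))) u<x)

  j₀ : Fin n
  j₀ = proj₁ first-return

  j : ℕ
  j = suc (toℕ j₀)

  a b : Fin n
  a = iterate f j x
  b = f a

  hopTarget≡a : hopTarget f x ≡ a
  hopTarget≡a = cong (maybe′ (λ t → iterate f (suc (toℕ t)) x) x) (proj₂ first-return)

  b<x : b Fin.< x
  b<x = <ᵇ⇒< (proj₁ (findFirst-just _ (proj₂ first-return)))

  not-below : ∀ i → i ℕ.< toℕ j₀ → ¬ (iterate f (2 + i) x Fin.< x)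
  not-below i i<j₀ below = contradiction (trans (sym (<⇒<ᵇ below′)) earlier) λ ()
    where
    i<n = ℕ.<-trans i<j₀ (Fin.toℕ<n j₀)
    i′ = fromℕ< i<n
    earlier = proj₂ (findFirst-just _ (proj₂ first-return)) i′ (subst (ℕ._< toℕ j₀) (sym (Fin.toℕ-fromℕ< i<n)) i<j₀)
    below′ : f (iterate f (suc (toℕ i′)) x) Fin.< x
    below′ = subst (λ k → iterate f (2 + k) x Fin.< x) (sym (Fin.toℕ-fromℕ< i<n)) below

  private
    returns-only-past-j : ∀ i → i ℕ.< toℕ j₀ → iterate f (2 + i) x ≢ x
    returns-only-past-j zero    _    e = Fin.<-irrefl (sym (f-injective (trans e (sym (f∘g x))))) (Fin.<-trans u<x x<v)
    returns-only-past-j (suc i) i<j₀ e = not-below i (ℕ.<-trans (ℕ.n<1+n i) i<j₀)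
      (subst (Fin._< x) (sym (f-injective (trans e (sym (f∘g x))))) u<x)

  above : ∀ i → 1 ℕ.≤ i → i ℕ.≤ j → x Fin.< iterate f i x
  above 1             _ _     = x<v
  above (suc (suc i)) _ 2+i≤j =
    ≮∧≢⇒> (not-below i (ℕ.s≤s⁻¹ 2+i≤j)) (returns-only-past-j i (ℕ.s≤s⁻¹ 2+i≤j))

  x<a : x Fin.< a
  x<a = above j (ℕ.s≤s ℕ.z≤n) ℕ.≤-refl

  private
    u<v : u Fin.< v
    u<v = Fin.<-trans u<x x<v
    b<v : b Fin.< v
    b<v = Fin.<-trans b<x x<v
    u<a : u Fin.< a
    u<a = Fin.<-trans u<x x<a
    b<a : b Fin.< a
    b<a = Fin.<-trans b<x x<a
    ≢-of-< : {p q : Fin n} → p Fin.< q → q ≢ p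
    ≢-of-< p<q = Fin.<⇒≢ p<q ∘ sym

  f′ g′ : Fin n → Fin n
  f′ = f [ a ↦ x ] [ x ↦ b ] [ u ↦ v ]
  g′ = g [ x ↦ a ] [ b ↦ x ] [ v ↦ u ]

  hopForward≗f′ : ∀ y → hopForward f g x y ≡ f′ y
  hopForward≗f′ = [↦]-cong ([↦]-cong ([↦]-cong (λ _ → refl) hopTarget≡a refl) refl (cong f hopTarget≡a)) refl refl

  hopBackward≗g′ : ∀ y → hopBackward f g x y ≡ g′ y
  hopBackward≗g′ = [↦]-cong ([↦]-cong ([↦]-cong (λ _ → refl) refl hopTarget≡a) (cong f hopTarget≡a) refl) refl refl

  f′u : f′ u ≡ v
  f′u = [↦]-here _ u v
  f′x : f′ x ≡ b
  f′x = trans ([↦]-there _ (Fin.<⇒≢ u<x ∘ sym)) ([↦]-here _ x b)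
  f′a : f′ a ≡ x
  f′a = trans ([↦]-there _ (≢-of-< u<a)) (trans ([↦]-there _ (≢-of-< x<a)) ([↦]-here f a x))
  f′-elsewhere : ∀ {y} → y ≢ u → y ≢ x → y ≢ a → f′ y ≡ f y
  f′-elsewhere y≢u y≢x y≢a = trans ([↦]-there _ y≢u) (trans ([↦]-there _ y≢x) ([↦]-there f y≢a))

  g′v : g′ v ≡ u
  g′v = [↦]-here _ v u
  g′b : g′ b ≡ x
  g′b = trans ([↦]-there _ (Fin.<⇒≢ b<v)) ([↦]-here _ b x)
  g′x : g′ x ≡ a
  g′x = trans ([↦]-there _ (Fin.<⇒≢ x<v)) (trans ([↦]-there _ (≢-of-< b<x)) ([↦]-here g x a))
  g′-elsewhere : ∀ {y} → y ≢ v → y ≢ b → y ≢ x → g′ y ≡ g y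
  g′-elsewhere y≢v y≢b y≢x = trans ([↦]-there _ y≢v) (trans ([↦]-there _ y≢b) ([↦]-there g y≢x))

  f′∘g′ : ∀ y → f′ (g′ y) ≡ y
  f′∘g′ y with y Fin.≟ v | y Fin.≟ b | y Fin.≟ x
  ... | yes refl | _        | _        = trans (cong f′ g′v) f′u
  ... | no _     | yes refl | _        = trans (cong f′ g′b) f′x
  ... | no _     | no _     | yes refl = trans (cong f′ g′x) f′a
  ... | no y≢v   | no y≢b   | no y≢x   = begin
    f′ (g′ y) ≡⟨ cong f′ (g′-elsewhere y≢v y≢b y≢x) ⟩
    f′ (g y)  ≡⟨ f′-elsewhere (λ e → y≢x (trans (sym (f∘g y)) (trans (cong f e) (f∘g x))))
                              (λ e → y≢v (trans (sym (f∘g y)) (cong f e)))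
                              (λ e → y≢b (trans (sym (f∘g y)) (cong f e))) ⟩
    f (g y)   ≡⟨ f∘g y ⟩
    y         ∎
    where open ≡-Reasoning

  g′∘f′ : ∀ y → g′ (f′ y) ≡ y
  g′∘f′ y with y Fin.≟ u | y Fin.≟ x | y Fin.≟ a
  ... | yes refl | _        | _        = trans (cong g′ f′u) g′v
  ... | no _     | yes refl | _        = trans (cong g′ f′x) g′b
  ... | no _     | no _     | yes refl = trans (cong g′ f′a) g′x
  ... | no y≢u   | no y≢x   | no y≢a   = begin
    g′ (f′ y) ≡⟨ cong g′ (f′-elsewhere y≢u y≢x y≢a) ⟩
    g′ (f y)  ≡⟨ g′-elsewhere (y≢x ∘ f-injective) (y≢a ∘ f-injective)
                              (λ e → y≢u (f-injective (trans e (sym (f∘g x))))) ⟩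
    g (f y)   ≡⟨ g∘f y ⟩
    y         ∎
    where open ≡-Reasoning

  f′-fpf : ∀ y → f′ y ≢ y
  f′-fpf y with y Fin.≟ u | y Fin.≟ x | y Fin.≟ a
  ... | yes refl | _        | _        = λ e → Fin.<⇒≢ u<v (sym (trans (sym f′u) e))
  ... | no _     | yes refl | _        = λ e → Fin.<⇒≢ b<x (trans (sym f′x) e)
  ... | no _     | no _     | yes refl = λ e → Fin.<⇒≢ x<a (trans (sym f′a) e)
  ... | no y≢u   | no y≢x   | no y≢a   = λ e → f-fpf y (trans (sym (f′-elsewhere y≢u y≢x y≢a)) e)

  g-fpf : ∀ y → g y ≢ y
  g-fpf y gy≡y = f-fpf y (trans (cong f (sym gy≡y)) (f∘g y))

  g′-fpf : ∀ y → g′ y ≢ y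
  g′-fpf y g′y≡y = f′-fpf y (trans (cong f′ (sym g′y≡y)) (f′∘g′ y))

  f′-below-preserved : ∀ y → y ≢ x → (f′ y <ᵇ y) ≡ (f y <ᵇ y)
  f′-below-preserved y y≢x with y Fin.≟ u | y Fin.≟ a
  ... | yes refl | _        = trans (cong (_<ᵇ u) f′u) (trans (>⇒<ᵇ u<v) (sym (trans (cong (_<ᵇ u) (f∘g x)) (>⇒<ᵇ u<x))))
  ... | no _     | yes refl = trans (cong (_<ᵇ a) f′a) (trans (<⇒<ᵇ x<a) (sym (<⇒<ᵇ b<a)))
  ... | no y≢u   | no y≢a   = cong (_<ᵇ y) (f′-elsewhere y≢u y≢x y≢a)

  g′-below-preserved : ∀ y → y ≢ x → (g′ y <ᵇ y) ≡ (g y <ᵇ y)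
  g′-below-preserved y y≢x with y Fin.≟ v | y Fin.≟ b
  ... | yes refl | _        = trans (cong (_<ᵇ v) g′v) (trans (<⇒<ᵇ u<v) (sym (trans (cong (_<ᵇ v) (g∘f x)) (<⇒<ᵇ x<v))))
  ... | no _     | yes refl = trans (cong (_<ᵇ b) g′b) (trans (>⇒<ᵇ b<x) (sym (trans (cong (_<ᵇ b) (g∘f a)) (>⇒<ᵇ b<a))))
  ... | no y≢v   | no y≢b   = cong (_<ᵇ y) (g′-elsewhere y≢v y≢b y≢x)

  cyclicDouble-preserved : ∀ y → y ≢ x → isCyclicDouble f′ g′ y ≡ isCyclicDouble f g y
  cyclicDouble-preserved y y≢x = cong₂ _xor_ (g′-below-preserved y y≢x) (f′-below-preserved y y≢x)

  excᶠ-f : excᶠ f ≡ suc (excᶠ f′)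
  excᶠ-f = length-filterᵇ-suc _ _ (Unique.allFin⁺ n) (∈-allFin x) (<⇒<ᵇ x<v) (trans (cong (x <ᵇ_) f′x) (>⇒<ᵇ b<x))
    λ {y} _ y≢x → begin
      y <ᵇ f y         ≡⟨ <ᵇ-flip (f-fpf y ∘ sym) ⟩
      not (f y <ᵇ y)   ≡⟨ cong not (f′-below-preserved y y≢x) ⟨
      not (f′ y <ᵇ y)  ≡⟨ <ᵇ-flip (f′-fpf y ∘ sym) ⟨
      y <ᵇ f′ y        ∎
    where open ≡-Reasoning

  excᶠ-g′ : excᶠ g′ ≡ suc (excᶠ g)
  excᶠ-g′ = length-filterᵇ-suc _ _ (Unique.allFin⁺ n) (∈-allFin x) (trans (cong (x <ᵇ_) g′x) (<⇒<ᵇ x<a)) (>⇒<ᵇ u<x)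
    λ {y} _ y≢x → begin
      y <ᵇ g′ y        ≡⟨ <ᵇ-flip (g′-fpf y ∘ sym) ⟩
      not (g′ y <ᵇ y)  ≡⟨ cong not (g′-below-preserved y y≢x) ⟩
      not (g y <ᵇ y)   ≡⟨ <ᵇ-flip (g-fpf y ∘ sym) ⟨
      y <ᵇ g y         ∎
    where open ≡-Reasoning

  private
    g′-steps-back : ∀ t → 1 ℕ.≤ t → suc t ℕ.≤ j → g′ (iterate f (suc t) x) ≡ iterate f t x
    g′-steps-back t 1≤t 1+t≤j = trans (g′-elsewhere ≢v ≢b ≢x) (g∘f (iterate f t x))
      where
      x<f¹⁺ᵗx = above (suc t) (ℕ.s≤s ℕ.z≤n) 1+t≤j
      ≢x = ≢-of-< x<f¹⁺ᵗx
      ≢b = ≢-of-< (Fin.<-trans b<x x<f¹⁺ᵗx)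
      ≢v : iterate f (suc t) x ≢ v
      ≢v e = Fin.<⇒≢ (above t 1≤t (ℕ.<⇒≤ 1+t≤j)) (sym (f-injective e))

    walk-back : ∀ d t → d + t ≡ j → 1 ℕ.≤ t → iterate g′ d a ≡ iterate f t x
    walk-back zero    t refl _   = refl
    walk-back (suc d) t e    1≤t = trans (cong g′ (walk-back d (suc t) (trans (ℕ.+-suc d t) e) (ℕ.s≤s ℕ.z≤n)))
      (g′-steps-back t 1≤t (subst (suc t ℕ.≤_) e (ℕ.s≤s (ℕ.m≤n+m t d))))

    g′-walk : ∀ i → i ℕ.≤ toℕ j₀ → iterate g′ (suc i) x ≡ iterate f (j ℕ.∸ i) x
    g′-walk i i≤j₀ = trans (iterate-suc′ g′ i x) (trans (cong (iterate g′ i) g′x)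
      (walk-back i (j ℕ.∸ i) (ℕ.m+[n∸m]≡n (ℕ.m≤n⇒m≤1+n i≤j₀)) (ℕ.m<n⇒0<n∸m (ℕ.s≤s i≤j₀))))

    g′-walk-ends-at-v : iterate g′ (suc (toℕ j₀)) x ≡ v
    g′-walk-ends-at-v = trans (g′-walk (toℕ j₀) ℕ.≤-refl)
      (cong (λ k → iterate f k x) (trans (ℕ.+-∸-assoc 1 (ℕ.≤-refl {toℕ j₀})) (cong suc (ℕ.n∸n≡0 (toℕ j₀)))))

    g′-walk-stays-above : (i : Fin n) → toℕ i ℕ.< toℕ j₀ → x Fin.< g′ (iterate g′ (suc (toℕ i)) x)
    g′-walk-stays-above i i<j₀ = subst (x Fin.<_) (sym (begin
      g′ (iterate g′ (suc (toℕ i)) x)  ≡⟨ cong g′ (g′-walk (toℕ i) (ℕ.<⇒≤ i<j₀)) ⟩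
      g′ (iterate f (j ℕ.∸ toℕ i) x)   ≡⟨ cong (λ k → g′ (iterate f k x)) (ℕ.+-∸-assoc 1 (ℕ.<⇒≤ i<j₀)) ⟩
      g′ (iterate f (suc t) x)         ≡⟨ g′-steps-back t 1≤t (ℕ.s≤s (ℕ.m∸n≤m (toℕ j₀) (toℕ i))) ⟩
      iterate f t x                    ∎))
      (above t 1≤t (ℕ.m≤n⇒m≤1+n (ℕ.m∸n≤m (toℕ j₀) (toℕ i))))
      where
      open ≡-Reasoning
      t = toℕ j₀ ℕ.∸ toℕ i
      1≤t = ℕ.m<n⇒0<n∸m i<j₀

  hopTarget-g′ : hopTarget g′ x ≡ v
  hopTarget-g′ = trans (cong (maybe′ (λ t → iterate g′ (suc (toℕ t)) x) x) first-return-g′) g′-walk-ends-at-v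
    where
    first-return-g′ : findFirst (returnsBelow g′ x) ≡ just j₀
    first-return-g′ = findFirst-least _ j₀
      (<⇒<ᵇ (subst (Fin._< x) (sym (trans (cong g′ g′-walk-ends-at-v) g′v)) u<x))
      (λ i i<j₀ → >⇒<ᵇ (g′-walk-stays-above i i<j₀))

  hopForward-involutive : ∀ y → hopForward g′ f′ x y ≡ g y
  hopForward-involutive y = trans
    ([↦]-cong ([↦]-cong ([↦]-cong (λ _ → refl) hopTarget-g′ refl) refl (trans (cong g′ hopTarget-g′) g′v)) f′x g′x y)
    (undo y)
    where
    undo : ∀ y → (g′ [ v ↦ x ] [ x ↦ u ] [ b ↦ a ]) y ≡ g y
    undo y with y Fin.≟ b | y Fin.≟ x | y Fin.≟ v
    ... | yes refl | _        | _        = trans ([↦]-here _ b a) (sym (g∘f a))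
    ... | no y≢b   | yes refl | _        = trans ([↦]-there _ y≢b) ([↦]-here _ x u)
    ... | no y≢b   | no y≢x   | yes refl =
      trans ([↦]-there _ y≢b) (trans ([↦]-there _ y≢x) (trans ([↦]-here g′ v x) (sym (g∘f x))))
    ... | no y≢b   | no y≢x   | no y≢v   =
      trans ([↦]-there _ y≢b) (trans ([↦]-there _ y≢x) (trans ([↦]-there g′ y≢v) (g′-elsewhere y≢v y≢b y≢x)))

  hopBackward-involutive : ∀ y → hopBackward g′ f′ x y ≡ f y
  hopBackward-involutive y = trans
    ([↦]-cong ([↦]-cong ([↦]-cong (λ _ → refl) refl hopTarget-g′) (trans (cong g′ hopTarget-g′) g′v) refl) g′x f′x y)
    (undo y)
    where
    undo : ∀ y → (f′ [ x ↦ v ] [ u ↦ x ] [ a ↦ b ]) y ≡ f y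
    undo y with y Fin.≟ a | y Fin.≟ u | y Fin.≟ x
    ... | yes refl | _        | _        = [↦]-here _ a b
    ... | no y≢a   | yes refl | _        = trans ([↦]-there _ y≢a) (trans ([↦]-here _ u x) (sym (f∘g x)))
    ... | no y≢a   | no y≢u   | yes refl = trans ([↦]-there _ y≢a) (trans ([↦]-there _ y≢u) ([↦]-here f′ x v))
    ... | no y≢a   | no y≢u   | no y≢x   =
      trans ([↦]-there _ y≢a) (trans ([↦]-there _ y≢u) (trans ([↦]-there f′ y≢x) (f′-elsewhere y≢u y≢x y≢a)))

module _ {n : ℕ} where

  firstCyclicDouble : Vec (Fin n) n → Maybe (Fin n)
  firstCyclicDouble σ = findFirst (isCyclicDouble (lookup σ) (inverse σ))

  hopAt : Vec (Fin n) n → Maybe (Fin n) → Vec (Fin n) n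
  hopAt σ nothing  = σ
  hopAt σ (just x) = if inverse σ x <ᵇ x
                     then tabulate (hopForward (lookup σ) (inverse σ) x)
                     else tabulate (hopBackward (inverse σ) (lookup σ) x)

  valleyHop : Vec (Fin n) n → Vec (Fin n) n
  valleyHop σ = hopAt σ (firstCyclicDouble σ)

  hopAt-ascent : (σ : Vec (Fin n) n) (x : Fin n) → (inverse σ x <ᵇ x) ≡ true →
    hopAt σ (just x) ≡ tabulate (hopForward (lookup σ) (inverse σ) x)
  hopAt-ascent σ x e rewrite e = refl

  hopAt-descent : (σ : Vec (Fin n) n) (x : Fin n) → (inverse σ x <ᵇ x) ≡ false →
    hopAt σ (just x) ≡ tabulate (hopBackward (inverse σ) (lookup σ) x)
  hopAt-descent σ x e rewrite e = refl

  noCyclicDouble : Vec (Fin n) n → Bool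
  noCyclicDouble σ = is-nothing (firstCyclicDouble σ)

  excSign : Vec (Fin n) n → ℤ
  excSign σ = negOnePow (exc σ)

  tabulate-inverse : (φ ψ : Fin n → Fin n) → (∀ y → φ (ψ y) ≡ y) → (∀ y → ψ (φ y) ≡ y) →
    IsPermutation (tabulate φ) × (∀ y → inverse (tabulate φ) y ≡ ψ y)
  tabulate-inverse φ ψ φ∘ψ ψ∘φ = perm , inverse-unique perm ψ (λ y → trans (Vec.lookup∘tabulate φ (ψ y)) (φ∘ψ y))
    where
    perm : IsPermutation (tabulate φ)
    perm = lookup-injective⇒ λ {i} {j} e → trans (sym (ψ∘φ i)) (trans (cong ψ (trans (sym (Vec.lookup∘tabulate φ i))
                       (trans e (Vec.lookup∘tabulate φ j)))) (ψ∘φ j))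

  tabulate-≗-lookup : {h : Fin n → Fin n} {σ : Vec (Fin n) n} → (∀ y → h y ≡ lookup σ y) → tabulate h ≡ σ
  tabulate-≗-lookup {σ = σ} h≗σ = trans (Vec.tabulate-cong h≗σ) (Vec.tabulate∘lookup σ)

  excᶠ-cong : {h h′ : Fin n → Fin n} → (∀ y → h y ≡ h′ y) → excᶠ h ≡ excᶠ h′
  excᶠ-cong h≗h′ = length-filterᵇ-cong _ _ {allFin n} λ {k} _ → cong (k <ᵇ_) (h≗h′ k)

  isCyclicDouble-cong : {f f′ g g′ : Fin n → Fin n} → (∀ y → f y ≡ f′ y) → (∀ y → g y ≡ g′ y) →
    ∀ y → isCyclicDouble f g y ≡ isCyclicDouble f′ g′ y
  isCyclicDouble-cong f≗f′ g≗g′ y = cong₂ _xor_ (cong (_<ᵇ y) (g≗g′ y)) (cong (_<ᵇ y) (f≗f′ y))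

  isCyclicDouble-comm : (f g : Fin n → Fin n) → ∀ y → isCyclicDouble f g y ≡ isCyclicDouble g f y
  isCyclicDouble-comm f g y = Bool.xor-comm (g y <ᵇ y) (f y <ᵇ y)

record Hopped {n : ℕ} (σ τ : Vec (Fin n) n) : Set where
  field
    permutation    : IsPermutation τ
    derangement    : FixedPointFree τ
    hops-back      : valleyHop τ ≡ σ
    sign-flips     : excSign τ ≡ - excSign σ

module HopStep {n : ℕ} {σ : Vec (Fin n) n} (perm : IsPermutation σ) (fpf : FixedPointFree σ)
    {x : Fin n} (first : firstCyclicDouble σ ≡ just x) where

  private
    f g : Fin n → Fin n
    f = lookup σ
    g = inverse σ
    f∘g : ∀ y → f (g y) ≡ y
    f∘g = lookup-inverse perm
    g∘f : ∀ y → g (f y) ≡ y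
    g∘f = inverse-lookup perm
    g-fpf : ∀ y → g y ≢ y
    g-fpf y gy≡y = fpf y (trans (cong f (sym gy≡y)) (f∘g y))
    x-double : isCyclicDouble f g x ≡ true
    x-double = proj₁ (findFirst-just _ first)
    before-x : ∀ i → i Fin.< x → isCyclicDouble f g i ≡ false
    before-x = proj₂ (findFirst-just _ first)

  ascent : (g x <ᵇ x) ≡ true → Hopped σ (hopAt σ (just x))
  ascent e = record
    { permutation    = subst IsPermutation (sym τ≡) perm′
    ; derangement    = subst FixedPointFree (sym τ≡) λ y → f′-fpf y ∘ trans (sym (lookup-τ y))
    ; hops-back      = trans (cong valleyHop τ≡) hops-back
    ; sign-flips     = trans (cong excSign τ≡) (trans (cong negOnePow (excᶠ-cong lookup-τ))
                         (trans (sym (ℤ.neg-involutive _)) (cong -_ (cong negOnePow (sym excᶠ-f)))))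
    }
    where
    x<v : x Fin.< f x
    x<v with f x <ᵇ x in e′
    ... | true  = contradiction (trans (sym x-double) (cong₂ _xor_ e e′)) λ ()
    ... | false = ≢ᵇ⇒< e′ (fpf x)
    open DoubleAscentHop f g f∘g g∘f fpf x (<ᵇ⇒< e) x<v
    τ = tabulate (hopForward f g x)
    τ≡ : hopAt σ (just x) ≡ τ
    τ≡ = hopAt-ascent σ x e
    lookup-τ : ∀ y → lookup τ y ≡ f′ y
    lookup-τ y = trans (Vec.lookup∘tabulate _ y) (hopForward≗f′ y)
    τ-inverse = tabulate-inverse (hopForward f g x) g′ (λ y → trans (hopForward≗f′ _) (f′∘g′ y))
                                                        (λ y → trans (cong g′ (hopForward≗f′ y)) (g′∘f′ y))
    perm′ = proj₁ τ-inverse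
    inverse-τ : ∀ y → inverse τ y ≡ g′ y
    inverse-τ = proj₂ τ-inverse
    first′ : firstCyclicDouble τ ≡ just x
    first′ = findFirst-least _ x
      (trans (isCyclicDouble-cong lookup-τ inverse-τ x)
             (cong₂ _xor_ (trans (cong (_<ᵇ x) g′x) (>⇒<ᵇ x<a)) (trans (cong (_<ᵇ x) f′x) (<⇒<ᵇ b<x))))
      (λ i i<x → trans (isCyclicDouble-cong lookup-τ inverse-τ i)
                       (trans (cyclicDouble-preserved i (Fin.<⇒≢ i<x)) (before-x i i<x)))
    hops-back : valleyHop τ ≡ σ
    hops-back = trans (cong (hopAt τ) first′)
      (trans (hopAt-descent τ x (trans (cong (_<ᵇ x) (trans (inverse-τ x) g′x)) (>⇒<ᵇ x<a)))
             (tabulate-≗-lookup λ y → trans (hopBackward-cong inverse-τ lookup-τ x y) (hopBackward-involutive y)))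

  descent : (g x <ᵇ x) ≡ false → Hopped σ (hopAt σ (just x))
  descent e = record
    { permutation    = subst IsPermutation (sym τ≡) perm′
    ; derangement    = subst FixedPointFree (sym τ≡) λ y → g′-fpf y ∘ trans (sym (lookup-τ y))
    ; hops-back      = trans (cong valleyHop τ≡) hops-back
    ; sign-flips     = trans (cong excSign τ≡) (cong negOnePow (trans (excᶠ-cong lookup-τ) excᶠ-g′))
    }
    where
    fx<x : f x Fin.< x
    fx<x with f x <ᵇ x in e′
    ... | true  = <ᵇ⇒< e′
    ... | false = contradiction (trans (sym x-double) (cong₂ _xor_ e e′)) λ ()
    open DoubleAscentHop g f g∘f f∘g g-fpf x fx<x (≢ᵇ⇒< e (g-fpf x))
    τ = tabulate (hopBackward g f x)
    τ≡ : hopAt σ (just x) ≡ τ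
    τ≡ = hopAt-descent σ x e
    lookup-τ : ∀ y → lookup τ y ≡ g′ y
    lookup-τ y = trans (Vec.lookup∘tabulate _ y) (hopBackward≗g′ y)
    τ-inverse = tabulate-inverse (hopBackward g f x) f′ (λ y → trans (hopBackward≗g′ _) (g′∘f′ y))
                                                        (λ y → trans (cong f′ (hopBackward≗g′ y)) (f′∘g′ y))
    perm′ = proj₁ τ-inverse
    inverse-τ : ∀ y → inverse τ y ≡ f′ y
    inverse-τ = proj₂ τ-inverse
    first′ : firstCyclicDouble τ ≡ just x
    first′ = findFirst-least _ x
      (trans (isCyclicDouble-cong lookup-τ inverse-τ x)
             (cong₂ _xor_ (trans (cong (_<ᵇ x) f′x) (<⇒<ᵇ b<x)) (trans (cong (_<ᵇ x) g′x) (>⇒<ᵇ x<a))))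
      (λ i i<x → trans (isCyclicDouble-cong lookup-τ inverse-τ i)
                 (trans (isCyclicDouble-comm g′ f′ i)
                 (trans (cyclicDouble-preserved i (Fin.<⇒≢ i<x))
                 (trans (isCyclicDouble-comm g f i) (before-x i i<x)))))
    hops-back : valleyHop τ ≡ σ
    hops-back = trans (cong (hopAt τ) first′)
      (trans (hopAt-ascent τ x (trans (cong (_<ᵇ x) (trans (inverse-τ x) f′x)) (<⇒<ᵇ b<x)))
             (tabulate-≗-lookup λ y → trans (hopForward-cong lookup-τ inverse-τ x y) (hopForward-involutive y)))

  hopped : Hopped σ (hopAt σ (just x))
  hopped = by-cases (g x <ᵇ x) refl
    where
    by-cases : ∀ c → (g x <ᵇ x) ≡ c → Hopped σ (hopAt σ (just x))
    by-cases true  = ascent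
    by-cases false = descent

module _ {n : ℕ} {σ : Vec (Fin n) n} (σ∈ : σ ∈ Derangements n) where

  private
    perm = proj₁ (∈-Derangements⁻ σ∈)
    fpf  = proj₂ (∈-Derangements⁻ σ∈)

  valleyHop-∈ : valleyHop σ ∈ Derangements n
  valleyHop-∈ with firstCyclicDouble σ in e
  ... | nothing = σ∈
  ... | just x  = ∈-Derangements⁺ permutation derangement
    where open Hopped (HopStep.hopped perm fpf e)

  valleyHop-involutive : valleyHop (valleyHop σ) ≡ σ
  valleyHop-involutive with firstCyclicDouble σ in e
  ... | nothing = cong (hopAt σ) e
  ... | just x  = Hopped.hops-back (HopStep.hopped perm fpf e)

  valleyHop-fixed : T (noCyclicDouble σ) → valleyHop σ ≡ σ
  valleyHop-fixed t with firstCyclicDouble σ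
  ... | nothing = refl

  valleyHop-sign : ¬ T (noCyclicDouble σ) → excSign (valleyHop σ) ≡ - excSign σ
  valleyHop-sign ¬t with firstCyclicDouble σ in e
  ... | nothing = contradiction _ ¬t
  ... | just x  = Hopped.sign-flips (HopStep.hopped perm fpf e)

PeakValleyDerangements : (n : ℕ) → List (Vec (Fin n) n)
PeakValleyDerangements n = filterᵇ noCyclicDouble (Derangements n)

B-at-minus-one≡sum-PeakValley : (n : ℕ) → B-at-minus-one n ≡ sumℤ (map excSign (PeakValleyDerangements n))
B-at-minus-one≡sum-PeakValley n = sumℤ-signReversingInvolution (excSign {n}) valleyHop noCyclicDouble
  Derangements-unique valleyHop-∈ valleyHop-involutive valleyHop-fixed valleyHop-sign

-- Foata's fundamental transformation

allBelow : ℕ → (ℕ → Bool) → Bool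
allBelow zero    p = true
allBelow (suc k) p = p k ∧ allBelow k p

module _ (p : ℕ → Bool) where

  allBelow-sound : ∀ i → allBelow i p ≡ true → ∀ j → j ℕ.< i → p j ≡ true
  allBelow-sound (suc i) e j j<1+i with p i in pi | ℕ.m≤n⇒m<n∨m≡n (ℕ.s≤s⁻¹ j<1+i)
  ... | true | inj₁ j<i  = allBelow-sound i e j j<i
  ... | true | inj₂ refl = pi

  allBelow-false : ∀ i → allBelow i p ≡ false → ∃[ j ] j ℕ.< i × p j ≡ false
  allBelow-false (suc i) e with p i in pi
  ... | false = i , ℕ.n<1+n i , pi
  ... | true  = let j , j<i , pj = allBelow-false i e in j , ℕ.m≤n⇒m≤1+n j<i , pj

module _ {n : ℕ} (w : Vec (Fin n) n) where

  valueIn : ℕ → List (Fin n) → ℕ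
  valueIn k []       = 0
  valueIn k (i ∷ is) = if toℕ i ℕ.≡ᵇ k then toℕ (lookup w i) else valueIn k is

  -- The same search as in isAlternating, so that the two can be identified; junk value 0 for k ≥ n.
  valueAt : ℕ → ℕ
  valueAt k = valueIn k (allFin n)

  valueIn-∈ : ∀ i {l} → i ∈ l → valueIn (toℕ i) l ≡ toℕ (lookup w i)
  valueIn-∈ i {j ∷ l} i∈ with toℕ j ℕ.≡ᵇ toℕ i in e | i∈
  ... | true  | _          = cong (toℕ ∘ lookup w) (to T-toℕ-≡ᵇ (from Bool.T-≡ e))
  ... | false | here refl  = contradiction (trans (sym e) (to Bool.T-≡ (ℕ.≡⇒≡ᵇ (toℕ j) (toℕ j) refl))) λ ()
  ... | false | there i∈′ = valueIn-∈ i i∈′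

  valueAt-toℕ : ∀ i → valueAt (toℕ i) ≡ toℕ (lookup w i)
  valueAt-toℕ i = valueIn-∈ i (∈-allFin i)

-- Cut w before each left-to-right maximum and read every block as a cycle; positions are
-- natural numbers below n.
module Foata {n : ℕ} (w : Vec (Fin n) n) where

  W : ℕ → ℕ
  W = valueAt w

  isLRMax : ℕ → Bool
  isLRMax i = allBelow i (λ j → W j ℕ.<ᵇ W i)

  blockStart : ℕ → ℕ
  blockStart zero    = zero
  blockStart (suc i) = if isLRMax (suc i) then suc i else blockStart i

  next : ℕ → ℕ
  next i = if (suc i ℕ.<ᵇ n) ∧ not (isLRMax (suc i)) then suc i else blockStart i

  isLRMax-< : ∀ {i} → isLRMax i ≡ true → ∀ j → j ℕ.< i → W j ℕ.< W i
  isLRMax-< {i} e j j<i = ℕᵇ.≡true⇒< (allBelow-sound _ i e j j<i)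

  ¬isLRMax-≥ : ∀ {i} → isLRMax i ≡ false → ∃[ j ] j ℕ.< i × W i ℕ.≤ W j
  ¬isLRMax-≥ {i} e = let j , j<i , pj = allBelow-false _ i e in j , j<i , ℕ.≮⇒≥ (ℕᵇ.≡false⇒≮ pj)

  blockStart-≤ : ∀ i → blockStart i ℕ.≤ i
  blockStart-≤ zero    = ℕ.z≤n
  blockStart-≤ (suc i) with isLRMax (suc i)
  ... | true  = ℕ.≤-refl
  ... | false = ℕ.m≤n⇒m≤1+n (blockStart-≤ i)

  blockStart-isLRMax : ∀ i → isLRMax (blockStart i) ≡ true
  blockStart-isLRMax zero    = refl
  blockStart-isLRMax (suc i) with isLRMax (suc i) in e
  ... | true  = e
  ... | false = blockStart-isLRMax i

  blockStart-LRMax : ∀ {i} → isLRMax i ≡ true → blockStart i ≡ i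
  blockStart-LRMax {zero}  _ = refl
  blockStart-LRMax {suc i} e rewrite e = refl

  blockStart-suc : ∀ {i} → isLRMax (suc i) ≡ false → blockStart (suc i) ≡ blockStart i
  blockStart-suc e rewrite e = refl

  blockStart-max : ∀ i j → j ℕ.≤ i → W j ℕ.≤ W (blockStart i)
  blockStart-max zero    zero _ = ℕ.≤-refl
  blockStart-max (suc i) j j≤1+i with isLRMax (suc i) in e | ℕ.m≤n⇒m<n∨m≡n j≤1+i
  ... | true  | inj₁ j<1+i = ℕ.<⇒≤ (isLRMax-< e j j<1+i)
  ... | true  | inj₂ refl  = ℕ.≤-refl
  ... | false | inj₁ j<1+i = blockStart-max i j (ℕ.s≤s⁻¹ j<1+i)
  ... | false | inj₂ refl  = let k , k<1+i , W≤ = ¬isLRMax-≥ e in ℕ.≤-trans W≤ (blockStart-max i k (ℕ.s≤s⁻¹ k<1+i))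

  blockStart-≥ : ∀ i t → isLRMax t ≡ true → t ℕ.≤ i → t ℕ.≤ blockStart i
  blockStart-≥ zero    t _ t≤0   = t≤0
  blockStart-≥ (suc i) t e t≤1+i with isLRMax (suc i) in e′ | ℕ.m≤n⇒m<n∨m≡n t≤1+i
  ... | true  | _          = t≤1+i
  ... | false | inj₁ t<1+i = blockStart-≥ i t e (ℕ.s≤s⁻¹ t<1+i)
  ... | false | inj₂ refl  = contradiction (trans (sym e′) e) λ ()

  data NextView (i : ℕ) : Set where
    inside : next i ≡ suc i → suc i ℕ.< n → isLRMax (suc i) ≡ false → NextView i
    wrap   : next i ≡ blockStart i → (suc i ℕ.< n → isLRMax (suc i) ≡ true) → NextView i

  nextView : ∀ i → NextView i
  nextView i with suc i ℕ.<ᵇ n in e₁ | isLRMax (suc i) in e₂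
  ... | true  | false = inside (cong₂ (λ c d → if c ∧ not d then suc i else blockStart i) e₁ e₂) (ℕᵇ.≡true⇒< e₁) e₂
  ... | true  | true  = wrap (cong₂ (λ c d → if c ∧ not d then suc i else blockStart i) e₁ e₂) (λ _ → e₂)
  ... | false | _     = wrap (cong (λ c → if c ∧ not (isLRMax (suc i)) then suc i else blockStart i) e₁)
                             (λ 1+i<n → contradiction 1+i<n (ℕᵇ.≡false⇒≮ e₁))

  next-< : ∀ {i} → i ℕ.< n → next i ℕ.< n
  next-< {i} i<n with nextView i
  ... | inside e 1+i<n _ rewrite e = 1+i<n
  ... | wrap   e _       rewrite e = ℕ.≤-<-trans (blockStart-≤ i) i<n

  blockStart-next : ∀ i → blockStart (next i) ≡ blockStart i
  blockStart-next i with nextView i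
  ... | inside e _ ¬max rewrite e = blockStart-suc ¬max
  ... | wrap   e _      rewrite e = blockStart-LRMax (blockStart-isLRMax i)

  blockStart-iterate-next : ∀ k i → blockStart (iterate next k i) ≡ blockStart i
  blockStart-iterate-next zero    i = refl
  blockStart-iterate-next (suc k) i = trans (blockStart-next _) (blockStart-iterate-next k i)

  next-reaches-blockStart : ∀ d i → d + i ≡ n → 1 ℕ.≤ d → ∃[ k ] iterate next k i ≡ blockStart i
  next-reaches-blockStart (suc d) i e _ with nextView i
  ... | wrap e′ _ = 1 , e′
  ... | inside e′ 1+i<n ¬max with d
  ...   | zero    = contradiction e (ℕ.<⇒≢ 1+i<n)
  ...   | suc d′  =
    let k , eₖ = next-reaches-blockStart (suc d′) (suc i) (trans (ℕ.+-suc (suc d′) i) e) (ℕ.s≤s ℕ.z≤n)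
    in suc k , trans (iterate-suc′ next k i) (trans (cong (iterate next k) e′) (trans eₖ (blockStart-suc ¬max)))

  nextFin : Fin n → Fin n
  nextFin i = fromℕ< (next-< (Fin.toℕ<n i))

foata : {n : ℕ} → Vec (Fin n) n → Vec (Fin n) n
foata w = tabulate (λ y → lookup w (Foata.nextFin w (inverse w y)))

module FoataPerm {n : ℕ} {w : Vec (Fin n) n} (perm : IsPermutation w) where
  open Foata w public

  w∘w⁻¹ : ∀ y → lookup w (inverse w y) ≡ y
  w∘w⁻¹ = lookup-inverse perm

  w⁻¹∘w : ∀ i → inverse w (lookup w i) ≡ i
  w⁻¹∘w = inverse-lookup perm

  W-fromℕ< : ∀ {j} (j<n : j ℕ.< n) → W j ≡ toℕ (lookup w (fromℕ< j<n))
  W-fromℕ< j<n = trans (cong W (sym (Fin.toℕ-fromℕ< j<n))) (valueAt-toℕ w _)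

  W-injective : ∀ {j k} → j ℕ.< n → k ℕ.< n → W j ≡ W k → j ≡ k
  W-injective j<n k<n e = trans (sym (Fin.toℕ-fromℕ< j<n)) (trans (cong toℕ fromℕ<≡) (Fin.toℕ-fromℕ< k<n))
    where
    fromℕ<≡ = IsPermutation.lookup-injective perm
      (Fin.toℕ-injective (trans (sym (W-fromℕ< j<n)) (trans e (W-fromℕ< k<n))))

  blockStart-> : ∀ {i} → i ℕ.< n → blockStart i ≢ i → W i ℕ.< W (blockStart i)
  blockStart-> {i} i<n ≢i = ℕ.≤∧≢⇒< (blockStart-max i i ℕ.≤-refl)
    (≢i ∘ sym ∘ W-injective i<n (ℕ.≤-<-trans (blockStart-≤ i) i<n))

  ¬isLRMax⇒blockStart-> : ∀ {i} → i ℕ.< n → isLRMax i ≡ false → W i ℕ.< W (blockStart i)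
  ¬isLRMax⇒blockStart-> {i} i<n ¬max = blockStart-> i<n λ e →
    contradiction (trans (sym ¬max) (trans (cong isLRMax (sym e)) (blockStart-isLRMax i))) λ ()

  private
    no-wrap-into-later-block : ∀ {p q} → q ℕ.< n → p ℕ.< q → blockStart p ≡ blockStart q →
      (suc p ℕ.< n → isLRMax (suc p) ≡ true) → ⊥
    no-wrap-into-later-block {p} {q} q<n p<q e max = ℕ.<-irrefl refl (ℕ.≤-<-trans
      (blockStart-≥ q (suc p) (max (ℕ.≤-<-trans p<q q<n)) p<q) (subst (ℕ._< suc p) e (ℕ.s≤s (blockStart-≤ p))))

  next-injective : ∀ {i i′} → i ℕ.< n → i′ ℕ.< n → next i ≡ next i′ → i ≡ i′
  next-injective {i} {i′} i<n i′<n e with nextView i | nextView i′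
  ... | inside e₁ _ _ | inside e₂ _ _ = ℕ.suc-injective (trans (sym e₁) (trans e e₂))
  ... | inside e₁ _ ¬max | wrap e₂ _ =
    contradiction (trans (sym ¬max) (trans (cong isLRMax (trans (sym e₁) (trans e e₂))) (blockStart-isLRMax i′))) λ ()
  ... | wrap e₁ _ | inside e₂ _ ¬max =
    contradiction (trans (sym ¬max) (trans (cong isLRMax (trans (sym e₂) (trans (sym e) e₁))) (blockStart-isLRMax i))) λ ()
  ... | wrap e₁ max₁ | wrap e₂ max₂ with ℕ.<-cmp i i′
  ...   | tri≈ _ i≡i′ _ = i≡i′
  ...   | tri< i<i′ _ _ = ⊥-elim (no-wrap-into-later-block i′<n i<i′ (trans (sym e₁) (trans e e₂)) max₁)
  ...   | tri> _ _ i′<i = ⊥-elim (no-wrap-into-later-block i<n i′<i (trans (sym e₂) (trans (sym e) e₁)) max₂)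

  toℕ-nextFin : ∀ i → toℕ (nextFin i) ≡ next (toℕ i)
  toℕ-nextFin i = Fin.toℕ-fromℕ< (next-< (Fin.toℕ<n i))

  foata-lookup : ∀ i → lookup (foata w) (lookup w i) ≡ lookup w (nextFin i)
  foata-lookup i = trans (Vec.lookup∘tabulate _ (lookup w i)) (cong (lookup w ∘ nextFin) (w⁻¹∘w i))

  toℕ-foata-lookup : ∀ i → toℕ (lookup (foata w) (lookup w i)) ≡ W (next (toℕ i))
  toℕ-foata-lookup i = trans (cong toℕ (foata-lookup i)) (trans (sym (valueAt-toℕ w _)) (cong W (toℕ-nextFin i)))

  foata-permutation : IsPermutation (foata w)
  foata-permutation = lookup-injective⇒ foata-injective
    where
    foata-injective : ∀ {y₁ y₂} → lookup (foata w) y₁ ≡ lookup (foata w) y₂ → y₁ ≡ y₂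
    foata-injective {y₁} {y₂} e = trans (sym (w∘w⁻¹ y₁)) (trans (cong (lookup w) i₁≡i₂) (w∘w⁻¹ y₂))
      where
      i₁ = inverse w y₁
      i₂ = inverse w y₂
      W-next≡ : W (next (toℕ i₁)) ≡ W (next (toℕ i₂))
      W-next≡ = begin
        W (next (toℕ i₁))                     ≡⟨ toℕ-foata-lookup i₁ ⟨
        toℕ (lookup (foata w) (lookup w i₁)) ≡⟨ cong (toℕ ∘ lookup (foata w)) (w∘w⁻¹ y₁) ⟩
        toℕ (lookup (foata w) y₁)             ≡⟨ cong toℕ e ⟩
        toℕ (lookup (foata w) y₂)             ≡⟨ cong (toℕ ∘ lookup (foata w)) (w∘w⁻¹ y₂) ⟨
        toℕ (lookup (foata w) (lookup w i₂)) ≡⟨ toℕ-foata-lookup i₂ ⟩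
        W (next (toℕ i₂))                     ∎
        where open ≡-Reasoning
      i₁≡i₂ : i₁ ≡ i₂
      i₁≡i₂ = Fin.toℕ-injective (next-injective (Fin.toℕ<n i₁) (Fin.toℕ<n i₂)
        (W-injective (next-< (Fin.toℕ<n i₁)) (next-< (Fin.toℕ<n i₂)) W-next≡))

  iterate-foata : ∀ k i → iterate (lookup (foata w)) k (lookup w i) ≡ lookup w (iterate nextFin k i)
  iterate-foata zero    i = refl
  iterate-foata (suc k) i = trans (cong (lookup (foata w)) (iterate-foata k i)) (foata-lookup _)

  toℕ-iterate-nextFin : ∀ k i → toℕ (iterate nextFin k i) ≡ iterate next k (toℕ i)
  toℕ-iterate-nextFin zero    i = refl
  toℕ-iterate-nextFin (suc k) i = trans (toℕ-nextFin _) (cong next (toℕ-iterate-nextFin k i))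

  toℕ-iterate-foata : ∀ k i → toℕ (iterate (lookup (foata w)) k (lookup w i)) ≡ W (iterate next k (toℕ i))
  toℕ-iterate-foata k i = trans (cong toℕ (iterate-foata k i))
    (trans (sym (valueAt-toℕ w _)) (cong W (toℕ-iterate-nextFin k i)))

IsCycleMax : {n : ℕ} → (Fin n → Fin n) → Fin n → Set
IsCycleMax h y = ∀ k → toℕ (iterate h k y) ℕ.≤ toℕ y

module _ {n : ℕ} {w : Vec (Fin n) n} (perm : IsPermutation w) where
  open FoataPerm perm

  -- The cycles of foata w are the blocks of w, and each block starts with its maximum.
  isLRMax⇒cycleMax : ∀ i → isLRMax (toℕ i) ≡ true → IsCycleMax (lookup (foata w)) (lookup w i)
  isLRMax⇒cycleMax i max k = begin
    toℕ (iterate (lookup (foata w)) k (lookup w i)) ≡⟨ toℕ-iterate-foata k i ⟩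
    W (iterate next k (toℕ i))                       ≤⟨ blockStart-max _ _ ℕ.≤-refl ⟩
    W (blockStart (iterate next k (toℕ i)))          ≡⟨ cong W (trans (blockStart-iterate-next k (toℕ i)) (blockStart-LRMax max)) ⟩
    W (toℕ i)                                        ≡⟨ valueAt-toℕ w i ⟩
    toℕ (lookup w i)                                 ∎
    where open ℕ.≤-Reasoning

  cycleMax⇒isLRMax : ∀ i → IsCycleMax (lookup (foata w)) (lookup w i) → isLRMax (toℕ i) ≡ true
  cycleMax⇒isLRMax i cycleMax with isLRMax (toℕ i) in e
  ... | true  = refl
  ... | false = contradiction (cycleMax k) (ℕ.<⇒≱ (begin-strict
    toℕ (lookup w i)                                 ≡⟨ valueAt-toℕ w i ⟨
    W (toℕ i)                                        <⟨ ¬isLRMax⇒blockStart-> i<n e ⟩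
    W (blockStart (toℕ i))                           ≡⟨ cong W reaches ⟨
    W (iterate next k (toℕ i))                       ≡⟨ toℕ-iterate-foata k i ⟨
    toℕ (iterate (lookup (foata w)) k (lookup w i)) ∎))
    where
    open ℕ.≤-Reasoning
    i<n = Fin.toℕ<n i
    k,reaches = next-reaches-blockStart (n ℕ.∸ toℕ i) (toℕ i) (ℕ.m∸n+n≡m (ℕ.<⇒≤ i<n)) (ℕ.m<n⇒0<n∸m i<n)
    k = proj₁ k,reaches
    reaches = proj₂ k,reaches

module FoataComparison {n : ℕ} {w w′ : Vec (Fin n) n} (perm : IsPermutation w) (perm′ : IsPermutation w′)
    (same : ∀ y → lookup (foata w) y ≡ lookup (foata w′) y) where

  private
    module A = FoataPerm perm
    module B = FoataPerm perm′

  AgreeBelow : ℕ → Set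
  AgreeBelow t = ∀ j → j ℕ.< t → A.W j ≡ B.W j

  private
    agree-at : ∀ {t} (t<n : t ℕ.< n) → AgreeBelow (suc t) → lookup w (fromℕ< t<n) ≡ lookup w′ (fromℕ< t<n)
    agree-at {t} t<n agree = Fin.toℕ-injective (begin
      toℕ (lookup w (fromℕ< t<n))  ≡⟨ A.W-fromℕ< t<n ⟨
      A.W t                        ≡⟨ agree t (ℕ.n<1+n t) ⟩
      B.W t                        ≡⟨ B.W-fromℕ< t<n ⟩
      toℕ (lookup w′ (fromℕ< t<n)) ∎)
      where open ≡-Reasoning

    next-agrees : ∀ {t} → suc t ℕ.< n → AgreeBelow (suc t) → A.W (A.next t) ≡ B.W (B.next t)
    next-agrees {t} 1+t<n agree = begin
      A.W (A.next t)                           ≡⟨ cong (A.W ∘ A.next) (Fin.toℕ-fromℕ< t<n) ⟨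
      A.W (A.next (toℕ i))                     ≡⟨ A.toℕ-foata-lookup i ⟨
      toℕ (lookup (foata w) (lookup w i))     ≡⟨ cong toℕ (trans (same _) (cong (lookup (foata w′)) (agree-at t<n agree))) ⟩
      toℕ (lookup (foata w′) (lookup w′ i))   ≡⟨ B.toℕ-foata-lookup i ⟩
      B.W (B.next (toℕ i))                     ≡⟨ cong (B.W ∘ B.next) (Fin.toℕ-fromℕ< t<n) ⟩
      B.W (B.next t)                           ∎
      where
      open ≡-Reasoning
      t<n = ℕ.<-trans (ℕ.n<1+n t) 1+t<n
      i = fromℕ< t<n

  non-LRMax-agrees : ∀ {t} → t ℕ.< n → AgreeBelow t → A.isLRMax t ≡ false → B.W t ≡ A.W t
  non-LRMax-agrees {zero}  _   _     ()
  non-LRMax-agrees {suc t} 1+t<n agree ¬max with A.nextView t | B.nextView t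
  ... | A.wrap _ max | _ = contradiction (trans (sym ¬max) (max 1+t<n)) λ ()
  ... | A.inside eA _ _ | B.inside eB _ _ =
    sym (trans (cong A.W (sym eA)) (trans (next-agrees 1+t<n agree) (cong B.W eB)))
  ... | A.inside eA _ _ | B.wrap eB _ = contradiction
    (A.W-injective 1+t<n (ℕ.≤-<-trans (B.blockStart-≤ t) t<n) (begin
      A.W (suc t)              ≡⟨ cong A.W eA ⟨
      A.W (A.next t)           ≡⟨ next-agrees 1+t<n agree ⟩
      B.W (B.next t)           ≡⟨ cong B.W eB ⟩
      B.W (B.blockStart t)     ≡⟨ agree _ (ℕ.s≤s (B.blockStart-≤ t)) ⟨
      A.W (B.blockStart t)     ∎))
    (λ e → ℕ.<-irrefl (sym e) (ℕ.s≤s (B.blockStart-≤ t)))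
    where
    open ≡-Reasoning
    t<n = ℕ.<-trans (ℕ.n<1+n t) 1+t<n

  -- B.W t is a cycle maximum of foata w′ = foata w, hence a left-to-right maximum wherever it sits in w.
  LRMax-≤ : ∀ {t} → t ℕ.< n → AgreeBelow t → B.isLRMax t ≡ true → A.W t ℕ.≤ B.W t
  LRMax-≤ {t} t<n agree maxB = by-position (inverse w y) (A.w∘w⁻¹ y)
    where
    y = lookup w′ (fromℕ< t<n)
    y≡B[t] : toℕ y ≡ B.W t
    y≡B[t] = sym (B.W-fromℕ< t<n)
    y-cycleMax : IsCycleMax (lookup (foata w)) y
    y-cycleMax k = subst (ℕ._≤ toℕ y) (cong toℕ (sym (iterate-cong same k y)))
      (isLRMax⇒cycleMax perm′ (fromℕ< t<n) (trans (cong B.isLRMax (Fin.toℕ-fromℕ< t<n)) maxB) k)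
    by-position : ∀ p → lookup w p ≡ y → A.W t ℕ.≤ B.W t
    by-position p w[p]≡y with ℕ.<-cmp (toℕ p) t
    ... | tri< p<t _ _ = contradiction (B.W-injective (ℕ.<-trans p<t t<n) t<n
                           (trans (sym (agree (toℕ p) p<t)) A[p]≡B[t])) (ℕ.<⇒≢ p<t)
      where A[p]≡B[t] = trans (valueAt-toℕ w p) (trans (cong toℕ w[p]≡y) y≡B[t])
    ... | tri≈ _ p≡t _ = ℕ.≤-reflexive (trans (cong A.W (sym p≡t)) (trans (valueAt-toℕ w p) (trans (cong toℕ w[p]≡y) y≡B[t])))
    ... | tri> _ _ t<p = ℕ.<⇒≤ (subst (A.W t ℕ.<_) (trans (valueAt-toℕ w p) (trans (cong toℕ w[p]≡y) y≡B[t]))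
                           (A.isLRMax-< (cycleMax⇒isLRMax perm p (subst (IsCycleMax _) (sym w[p]≡y) y-cycleMax)) t t<p))

foata-injective : {n : ℕ} {w w′ : Vec (Fin n) n} → IsPermutation w → IsPermutation w′ →
  foata w ≡ foata w′ → w ≡ w′
foata-injective {n} {w} {w′} perm perm′ eq = lookup-ext λ i → Fin.toℕ-injective (begin
  toℕ (lookup w i)  ≡⟨ valueAt-toℕ w i ⟨
  valueAt w (toℕ i)  ≡⟨ agree-below n ℕ.≤-refl (toℕ i) (Fin.toℕ<n i) ⟩
  valueAt w′ (toℕ i) ≡⟨ valueAt-toℕ w′ i ⟩
  toℕ (lookup w′ i) ∎)
  where
  open ≡-Reasoning
  same : ∀ y → lookup (foata w) y ≡ lookup (foata w′) y
  same y = cong (λ σ → lookup σ y) eq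
  module C  = FoataComparison perm perm′ same
  module C′ = FoataComparison perm′ perm (sym ∘ same)
  lookup-ext : (∀ i → lookup w i ≡ lookup w′ i) → w ≡ w′
  lookup-ext w≗w′ = trans (sym (Vec.tabulate∘lookup w)) (tabulate-≗-lookup w≗w′)
  agree-at : ∀ {t} → t ℕ.< n → C.AgreeBelow t → valueAt w t ≡ valueAt w′ t
  agree-at {t} t<n agree with Foata.isLRMax w t in e | Foata.isLRMax w′ t in e′
  ... | false | _     = sym (C.non-LRMax-agrees t<n agree e)
  ... | true  | false = C′.non-LRMax-agrees t<n (λ j j<t → sym (agree j j<t)) e′
  ... | true  | true  = ℕ.≤-antisym (C.LRMax-≤ t<n agree e′) (C′.LRMax-≤ t<n (λ j j<t → sym (agree j j<t)) e)
  agree-below : ∀ t → t ℕ.≤ n → C.AgreeBelow t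
  agree-below (suc t) 1+t≤n j j<1+t with ℕ.m≤n⇒m<n∨m≡n (ℕ.s≤s⁻¹ j<1+t)
  ... | inj₁ j<t  = agree-below t (ℕ.<⇒≤ 1+t≤n) j j<t
  ... | inj₂ refl = agree-at 1+t≤n (agree-below t (ℕ.<⇒≤ 1+t≤n))

-- Alternating words and alternating cycles

odd : ℕ → Bool
odd zero          = false
odd (suc zero)    = true
odd (suc (suc k)) = odd k

odd-suc : ∀ k → odd (suc k) ≡ not (odd k)
odd-suc zero          = refl
odd-suc (suc zero)    = refl
odd-suc (suc (suc k)) = odd-suc k

odd-suc-of-even : ∀ k → odd k ≡ false → odd (suc k) ≡ true
odd-suc-of-even k even-k = trans (odd-suc k) (cong not even-k)

odd-suc-of-odd : ∀ k → odd k ≡ true → odd (suc k) ≡ false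
odd-suc-of-odd k odd-k = trans (odd-suc k) (cong not odd-k)

Alternating : {n : ℕ} → Vec (Fin n) n → Set
Alternating {n} w = ∀ m → suc m ℕ.< n → odd (suc m) ≡ true →
  valueAt w (suc m) ℕ.< valueAt w m × (suc (suc m) ℕ.< n → valueAt w (suc m) ℕ.< valueAt w (suc (suc m)))

module _ {n : ℕ} (w : Vec (Fin n) n) where

  private
    W = valueAt w

  alternatingAt : ℕ → Bool
  alternatingAt zero    = true
  alternatingAt (suc m) = if odd (suc m)
    then (W (suc m) ℕ.<ᵇ W m) ∧ (if suc (suc m) ℕ.<ᵇ n then W (suc m) ℕ.<ᵇ W (suc (suc m)) else true)
    else true

  private
    conditionOf : {p : Fin n → Bool} → all p (allFin n) ≡ isAlternating w → Fin n → Bool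
    conditionOf {p} _ = p

    odd-unique : (o : ℕ → Bool) → o 0 ≡ false → o 1 ≡ true → (∀ k → o (suc (suc k)) ≡ o k) → ∀ k → o k ≡ odd k
    odd-unique o o₀ o₁ o₂ zero          = o₀
    odd-unique o o₀ o₁ o₂ (suc zero)    = o₁
    odd-unique o o₀ o₁ o₂ (suc (suc k)) = trans (o₂ k) (odd-unique o o₀ o₁ o₂ k)

    valueIn-unique : (go : ℕ → List (Fin n) → ℕ) → (∀ k → go k [] ≡ 0) →
      (∀ k i is → go k (i ∷ is) ≡ (if toℕ i ℕ.≡ᵇ k then toℕ (lookup w i) else go k is)) →
      ∀ k l → go k l ≡ valueIn w k l
    valueIn-unique go go₀ go₁ k []       = go₀ k
    valueIn-unique go go₀ go₁ k (i ∷ is) =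
      trans (go₁ k i is) (cong (if toℕ i ℕ.≡ᵇ k then toℕ (lookup w i) else_) (valueIn-unique go go₀ go₁ k is))

  -- The parity test and value lookup of isAlternating are local to its where-block and cannot be
  -- named. Abstracting the connectives makes the goal rigid, so that unification instantiates the
  -- functions in odd-unique and valueIn-unique with exactly those local helpers.
  isAlternating-condition : ∀ i → conditionOf refl i ≡ alternatingAt (toℕ i)
  isAlternating-condition i
    with toℕ i | odd-unique _ refl refl (λ _ → refl) | valueIn-unique _ (λ _ → refl) (λ _ _ _ → refl)
  ... | zero  | _ | _ = refl
  ... | suc m | isOdd≡odd | go≡valueIn with suc m | allFin n | if_then_else_ {A = Bool} | ℕ._<ᵇ_ | _∧_
  ... | b | L | ite | lt | and = cong₂ (λ o c → ite o c true) (isOdd≡odd b)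
    (cong₂ and (cong₂ lt (go≡valueIn b L) (go≡valueIn m L))
               (cong (λ c → ite (lt (suc b) n) c true) (cong₂ lt (go≡valueIn b L) (go≡valueIn (suc b) L))))

  T-isAlternating : T (isAlternating w) ⇔ Alternating w
  T-isAlternating = mk⇔
    (λ t m 1+m<n odd-1+m → at-odd m 1+m<n odd-1+m (subst T (isAlternating-condition (fromℕ< 1+m<n))
      (to (T-all-allFin _) t (fromℕ< 1+m<n))))
    (λ alt → from (T-all-allFin _) λ i →
      subst T (sym (isAlternating-condition i)) (holds alt (toℕ i) (Fin.toℕ<n i)))
    where
    at-odd : ∀ m (1+m<n : suc m ℕ.< n) → odd (suc m) ≡ true → T (alternatingAt (toℕ (fromℕ< 1+m<n))) →
      W (suc m) ℕ.< W m × (suc (suc m) ℕ.< n → W (suc m) ℕ.< W (suc (suc m)))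
    at-odd m 1+m<n o t rewrite Fin.toℕ-fromℕ< 1+m<n | o =
      let down , up = to Bool.T-∧ t in
      ℕ.<ᵇ⇒< _ _ down , λ 2+m<n → ℕ.<ᵇ⇒< _ _
        (subst (λ c → T (if c then W (suc m) ℕ.<ᵇ W (suc (suc m)) else true)) (ℕᵇ.<⇒≡true 2+m<n) up)
    holds : Alternating w → ∀ k → k ℕ.< n → T (alternatingAt k)
    holds alt zero    _ = _
    holds alt (suc m) 1+m<n with odd (suc m) in o
    ... | false = _
    ... | true  = from Bool.T-∧ (ℕ.<⇒<ᵇ (proj₁ (alt m 1+m<n o)) , up)
      where
      up : T (if suc (suc m) ℕ.<ᵇ n then W (suc m) ℕ.<ᵇ W (suc (suc m)) else true)
      up with suc (suc m) ℕ.<ᵇ n in e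
      ... | true  = ℕ.<⇒<ᵇ (proj₂ (alt m 1+m<n o) (ℕᵇ.≡true⇒< e))
      ... | false = _

module FoataParity {n : ℕ} {w : Vec (Fin n) n} (perm : IsPermutation w) where
  open FoataPerm perm

  NoSingletonBlock : Set
  NoSingletonBlock = ∀ i → i ℕ.< n → next i ≢ i

  BlocksAlternate : Set
  BlocksAlternate = ∀ i → i ℕ.< n → (W i ℕ.<ᵇ W (next i)) ≡ (W (next (next i)) ℕ.<ᵇ W (next i))

  private
    W-≢ : ∀ {j k} → j ℕ.< n → k ℕ.< n → j ≢ k → W j ≢ W k
    W-≢ j<n k<n j≢k = j≢k ∘ W-injective j<n k<n

    <ᵇ-flipℕ : ∀ {a b} → a ≢ b → (a ℕ.<ᵇ b) ≡ not (b ℕ.<ᵇ a)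
    <ᵇ-flipℕ {a} {b} a≢b with ℕ.<-cmp a b
    ... | tri< a<b _ _ = trans (ℕᵇ.<⇒≡true a<b) (cong not (sym (ℕᵇ.≮⇒≡false (ℕ.<-asym a<b))))
    ... | tri≈ _ a≡b _ = contradiction a≡b a≢b
    ... | tri> _ _ b<a = trans (ℕᵇ.≮⇒≡false (ℕ.<-asym b<a)) (cong not (sym (ℕᵇ.<⇒≡true b<a)))

    true≢false : ∀ {b} → b ≡ true → b ≡ false → ⊥
    true≢false refl ()

  module FromBlocks (noSingleton : NoSingletonBlock) (alternate : BlocksAlternate) where

    private
      odd-before-wrap : ∀ {i} → i ℕ.< n → next i ≡ blockStart i → (W (next i) ℕ.<ᵇ W i) ≡ not (odd i) →
        odd i ≡ true
      odd-before-wrap {i} i<n e step with odd i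
      ... | true  = refl
      ... | false = ⊥-elim (true≢false step (trans (cong (λ z → W z ℕ.<ᵇ W i) e) (ℕᵇ.≮⇒≡false (ℕ.<-asym
              (blockStart-> i<n (λ b≡i → noSingleton i i<n (trans e b≡i)))))))

    descends-after-even : ∀ i → i ℕ.< n → (W (next i) ℕ.<ᵇ W i) ≡ not (odd i)
    descends-after-even zero 0<n with nextView zero
    ... | wrap e _ = contradiction e (noSingleton 0 0<n)
    ... | inside e 1<n ¬max = trans (cong (λ z → W z ℕ.<ᵇ W 0) e) (ℕᵇ.<⇒≡true W1<W0)
      where
      W1<W0 : W 1 ℕ.< W 0
      W1<W0 with j , j<1 , W1≤Wj ← ¬isLRMax-≥ ¬max with refl ← ℕ.n<1⇒n≡0 j<1 =
        ℕ.≤∧≢⇒< W1≤Wj (W-≢ 1<n 0<n λ ())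
    descends-after-even (suc i) 1+i<n with nextView i | descends-after-even i (ℕ.<-trans (ℕ.n<1+n i) 1+i<n)
    ... | inside e _ _ | IH = begin
      W (next (suc i)) ℕ.<ᵇ W (suc i) ≡⟨ subst (λ z → (W i ℕ.<ᵇ W z) ≡ (W (next z) ℕ.<ᵇ W z)) e (alternate i i<n) ⟨
      W i ℕ.<ᵇ W (suc i)              ≡⟨ <ᵇ-flipℕ (W-≢ i<n 1+i<n (ℕ.<⇒≢ (ℕ.n<1+n i))) ⟩
      not (W (suc i) ℕ.<ᵇ W i)        ≡⟨ cong not (subst (λ z → (W z ℕ.<ᵇ W i) ≡ not (odd i)) e IH) ⟩
      not (not (odd i))               ≡⟨ cong not (odd-suc i) ⟨
      not (odd (suc i))               ∎
      where
      open ≡-Reasoning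
      i<n = ℕ.<-trans (ℕ.n<1+n i) 1+i<n
    ... | wrap e max | IH = trans descends (sym (trans (cong not (odd-suc i)) (trans (Bool.not-involutive _)
                              (odd-before-wrap i<n e IH))))
      where
      i<n = ℕ.<-trans (ℕ.n<1+n i) 1+i<n
      max₁ = max 1+i<n
      descends : (W (next (suc i)) ℕ.<ᵇ W (suc i)) ≡ true
      descends with nextView (suc i)
      ... | inside e′ 2+i<n ¬max = trans (cong (λ z → W z ℕ.<ᵇ W (suc i)) e′) (ℕᵇ.<⇒≡true
              (subst (λ z → W (suc (suc i)) ℕ.< W z) (trans (blockStart-suc ¬max) (blockStart-LRMax max₁))
                     (¬isLRMax⇒blockStart-> 2+i<n ¬max)))
      ... | wrap e′ _ = contradiction (trans e′ (blockStart-LRMax max₁)) (noSingleton (suc i) 1+i<n)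

    alternating : Alternating w
    alternating m 1+m<n odd-1+m = W[1+m]<W[m] , W[1+m]<W[2+m]
      where
      m<n = ℕ.<-trans (ℕ.n<1+n m) 1+m<n
      down : (W (next m) ℕ.<ᵇ W m) ≡ true
      down = trans (descends-after-even m m<n) (trans (sym (odd-suc m)) odd-1+m)
      W[1+m]<W[m] : W (suc m) ℕ.< W m
      W[1+m]<W[m] with nextView m
      ... | inside e _ _ = ℕᵇ.≡true⇒< (subst (λ z → (W z ℕ.<ᵇ W m) ≡ true) e down)
      ... | wrap e _ = contradiction (blockStart-max m m ℕ.≤-refl)
                         (ℕ.<⇒≱ (ℕᵇ.≡true⇒< (subst (λ z → (W z ℕ.<ᵇ W m) ≡ true) e down)))
      W[1+m]<W[2+m] : suc (suc m) ℕ.< n → W (suc m) ℕ.< W (suc (suc m))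
      W[1+m]<W[2+m] 2+m<n with nextView (suc m)
      ... | wrap _ max = isLRMax-< (max 2+m<n) (suc m) (ℕ.n<1+n (suc m))
      ... | inside e _ _ = subst (λ z → W (suc m) ℕ.< W z) e (ℕ.≤∧≢⇒< (ℕ.≮⇒≥ (ℕᵇ.≡false⇒≮ up))
              (W-≢ 1+m<n (next-< 1+m<n) (noSingleton (suc m) 1+m<n ∘ sym)))
        where
        up : (W (next (suc m)) ℕ.<ᵇ W (suc m)) ≡ false
        up = trans (descends-after-even (suc m) 1+m<n) (cong not odd-1+m)

    even : odd n ≡ false
    even = last-step n refl
      where
      last-step : ∀ k → n ≡ k → odd k ≡ false
      last-step zero    _ = refl
      last-step (suc k) n≡1+k with nextView k
      ... | inside _ 1+k<n _ = contradiction (sym n≡1+k) (ℕ.<⇒≢ 1+k<n)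
      ... | wrap e _ = trans (odd-suc k) (cong not (odd-before-wrap k<n e (descends-after-even k k<n)))
        where k<n = subst (k ℕ.<_) (sym n≡1+k) (ℕ.n<1+n k)

  module FromAlternating (alternating : Alternating w) (even : odd n ≡ false) where

    LRMax-even : ∀ {i} → i ℕ.< n → isLRMax i ≡ true → odd i ≡ false
    LRMax-even {zero}  _     _   = refl
    LRMax-even {suc m} 1+m<n max with odd (suc m) in o
    ... | false = refl
    ... | true  = contradiction (isLRMax-< max m (ℕ.n<1+n m)) (ℕ.<-asym (proj₁ (alternating m 1+m<n o)))

    even-not-last : ∀ {i} → i ℕ.< n → odd i ≡ false → suc i ℕ.< n
    even-not-last {i} i<n even-i with ℕ.m≤n⇒m<n∨m≡n i<n
    ... | inj₁ 1+i<n = 1+i<n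
    ... | inj₂ 1+i≡n = contradiction (trans (sym (odd-suc-of-even i even-i)) (trans (cong odd 1+i≡n) even)) λ ()

    step-from-even : ∀ {i} → i ℕ.< n → odd i ≡ false → next i ≡ suc i × W (next i) ℕ.< W i
    step-from-even {i} i<n even-i with nextView i | even-not-last i<n even-i
    ... | inside e _ _ | 1+i<n = e , subst (λ z → W z ℕ.< W i) (sym e) (proj₁ (alternating i 1+i<n (odd-suc-of-even i even-i)))
    ... | wrap _ max   | 1+i<n = contradiction (trans (sym (LRMax-even 1+i<n (max 1+i<n))) (odd-suc-of-even i even-i)) λ ()

    step-from-odd : ∀ {i} → i ℕ.< n → odd i ≡ true → W i ℕ.< W (next i) × odd (next i) ≡ false
    step-from-odd {zero}  _     ()
    step-from-odd {suc m} 1+m<n odd-1+m with nextView (suc m)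
    ... | inside e 2+m<n _ = subst (λ z → W (suc m) ℕ.< W z) (sym e) (proj₂ (alternating m 1+m<n odd-1+m) 2+m<n)
                           , trans (cong odd e) (odd-suc-of-odd (suc m) odd-1+m)
    ... | wrap e _ = subst (λ z → W (suc m) ℕ.< W z) (sym e) (blockStart-> 1+m<n start≢)
                   , trans (cong odd e) even-start
      where
      even-start : odd (blockStart (suc m)) ≡ false
      even-start = LRMax-even (ℕ.≤-<-trans (blockStart-≤ (suc m)) 1+m<n) (blockStart-isLRMax (suc m))
      start≢ : blockStart (suc m) ≢ suc m
      start≢ e′ = contradiction (trans (sym even-start) (trans (cong odd e′) odd-1+m)) λ ()

    noSingleton : NoSingletonBlock
    noSingleton i i<n e with odd i in o
    ... | false = ℕ.<-irrefl (trans (sym e) (proj₁ (step-from-even i<n o))) (ℕ.n<1+n i)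
    ... | true  = contradiction (trans (sym (proj₂ (step-from-odd i<n o))) (trans (cong odd e) o)) λ ()

    ascends-at-odd : ∀ i → i ℕ.< n → (W i ℕ.<ᵇ W (next i)) ≡ odd i
    ascends-at-odd i i<n with odd i in o
    ... | false = ℕᵇ.≮⇒≡false (ℕ.<-asym (proj₂ (step-from-even i<n o)))
    ... | true  = ℕᵇ.<⇒≡true (proj₁ (step-from-odd i<n o))

    alternate : BlocksAlternate
    alternate i i<n with odd i in o
    ... | false = trans (ascends-at-odd i i<n) (trans o (sym (ℕᵇ.≮⇒≡false (ℕ.<-asym (proj₁ (step-from-odd next<n odd-next))))))
      where
      next<n = next-< i<n
      odd-next = trans (cong odd (proj₁ (step-from-even i<n o))) (odd-suc-of-even i o)
    ... | true  = trans (ascends-at-odd i i<n) (trans o (sym (ℕᵇ.<⇒≡true (proj₂ (step-from-even next<n even-next)))))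
      where
      next<n = next-< i<n
      even-next = proj₂ (step-from-odd i<n o)

module _ {A : Set} (p : A → Bool) where

  +length-filterᵇ : (xs : List A) → + length (filterᵇ p xs) ≡ sumℤ (map (λ x → if p x then + 1 else + 0) xs)
  +length-filterᵇ xs = begin
    + length (filterᵇ p xs)                     ≡⟨ ℤ.*-identityʳ _ ⟨
    + length (filterᵇ p xs) *ℤ + 1              ≡⟨ sumℤ-map-const (+ 1) (filterᵇ p xs) ⟨
    sumℤ (map (λ _ → + 1) (filterᵇ p xs))       ≡⟨ sumℤ-map-filterᵇ p (λ _ → + 1) xs ⟩
    sumℤ (map (λ x → if p x then + 1 else + 0) xs) ∎
    where open ≡-Reasoning

length-filterᵇ-permute : {n : ℕ} {w : Vec (Fin n) n} → IsPermutation w → (p : Fin n → Bool) →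
  length (filterᵇ p (allFin n)) ≡ length (filterᵇ (p ∘ lookup w) (allFin n))
length-filterᵇ-permute {n} {w} perm p = ℤ.+-injective (begin
  + length (filterᵇ p (allFin n))                          ≡⟨ +length-filterᵇ p (allFin n) ⟩
  sumℤ (map indicator (allFin n))                          ≡⟨ sumℤ-reindex indicator (lookup w) u u
                                                                (λ _ _ → IsPermutation.lookup-injective perm)
                                                                (λ _ → ∈-allFin _)
                                                                (λ {y} _ → inverse w y , ∈-allFin _ , sym (lookup-inverse perm y)) ⟩
  sumℤ (map (indicator ∘ lookup w) (allFin n))             ≡⟨ +length-filterᵇ (p ∘ lookup w) (allFin n) ⟨
  + length (filterᵇ (p ∘ lookup w) (allFin n))             ∎)
  where
  open ≡-Reasoning
  u = Unique.allFin⁺ n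
  indicator : Fin n → ℤ
  indicator k = if p k then + 1 else + 0

count-odd-positions : ∀ n {A : Set} (q : A → Bool) (f : Fin n → A) → (∀ i → q (f i) ≡ odd (toℕ i)) →
  length (filterᵇ q (Data.List.tabulate f)) ≡ ℕ.⌊ n /2⌋
count-odd-positions zero          q f _      = refl
count-odd-positions (suc zero)    q f parity rewrite parity Fin.zero = refl
count-odd-positions (suc (suc n)) q f parity rewrite parity Fin.zero | parity (Fin.suc Fin.zero) =
  cong suc (count-odd-positions n q (f ∘ Fin.suc ∘ Fin.suc) (parity ∘ Fin.suc ∘ Fin.suc))

xor-false⇒≡ : ∀ a b → a xor b ≡ false → a ≡ b
xor-false⇒≡ false false _ = refl
xor-false⇒≡ true  true  _ = refl

module FoataCycles {n : ℕ} {w : Vec (Fin n) n} (perm : IsPermutation w) where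
  open FoataPerm perm
  open FoataParity perm

  private
    σ : Vec (Fin n) n
    σ = foata w
    f g : Fin n → Fin n
    f = lookup σ
    g = inverse σ
    σ-perm = foata-permutation

  fixedPointFree⇒noSingleton : FixedPointFree σ → NoSingletonBlock
  fixedPointFree⇒noSingleton fpf t t<n next≡t = fpf (lookup w i) (Fin.toℕ-injective (begin
    toℕ (f (lookup w i))  ≡⟨ toℕ-foata-lookup i ⟩
    W (next (toℕ i))       ≡⟨ cong (W ∘ next) (Fin.toℕ-fromℕ< t<n) ⟩
    W (next t)             ≡⟨ cong W next≡t ⟩
    W t                    ≡⟨ W-fromℕ< t<n ⟩
    toℕ (lookup w i)      ∎))
    where
    open ≡-Reasoning
    i = fromℕ< t<n

  noSingleton⇒fixedPointFree : NoSingletonBlock → FixedPointFree σ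
  noSingleton⇒fixedPointFree noSingleton k σk≡k = noSingleton (toℕ i) i<n (W-injective (next-< i<n) i<n (begin
    W (next (toℕ i))       ≡⟨ toℕ-foata-lookup i ⟨
    toℕ (f (lookup w i))  ≡⟨ cong (toℕ ∘ f) (w∘w⁻¹ k) ⟩
    toℕ (f k)              ≡⟨ cong toℕ σk≡k ⟩
    toℕ k                  ≡⟨ cong toℕ (w∘w⁻¹ k) ⟨
    toℕ (lookup w i)      ≡⟨ valueAt-toℕ w i ⟨
    W (toℕ i)              ∎))
    where
    open ≡-Reasoning
    i = inverse w k
    i<n = Fin.toℕ<n i

  cyclicDouble-at : ∀ i → isCyclicDouble f g (f (lookup w i)) ≡
    (W (toℕ i) ℕ.<ᵇ W (next (toℕ i))) xor (W (next (next (toℕ i))) ℕ.<ᵇ W (next (toℕ i)))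
  cyclicDouble-at i = cong₂ _xor_
    (cong₂ ℕ._<ᵇ_ (trans (cong toℕ (inverse-lookup σ-perm (lookup w i))) (sym (valueAt-toℕ w i))) (toℕ-iterate-foata 1 i))
    (cong₂ ℕ._<ᵇ_ (toℕ-iterate-foata 2 i) (toℕ-iterate-foata 1 i))

  noCyclicDouble⇒alternate : T (noCyclicDouble σ) → BlocksAlternate
  noCyclicDouble⇒alternate t with firstCyclicDouble σ in e
  ... | nothing = λ t t<n → let i = fromℕ< t<n in
    subst (λ k → (W k ℕ.<ᵇ W (next k)) ≡ (W (next (next k)) ℕ.<ᵇ W (next k))) (Fin.toℕ-fromℕ< t<n)
      (xor-false⇒≡ _ _ (trans (sym (cyclicDouble-at i)) (findFirst-nothing _ e (f (lookup w i)))))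

  alternate⇒noCyclicDouble : BlocksAlternate → T (noCyclicDouble σ)
  alternate⇒noCyclicDouble alternate with firstCyclicDouble σ in e
  ... | nothing = _
  ... | just x  = contradiction (trans (sym (proj₁ (findFirst-just _ e))) (begin
    isCyclicDouble f g x                   ≡⟨ cong (isCyclicDouble f g) (lookup-inverse σ-perm x) ⟨
    isCyclicDouble f g (f (g x))           ≡⟨ cong (isCyclicDouble f g ∘ f) (w∘w⁻¹ (g x)) ⟨
    isCyclicDouble f g (f (lookup w i))    ≡⟨ cyclicDouble-at i ⟩
    ascends xor descends                   ≡⟨ cong (_xor descends) (alternate (toℕ i) (Fin.toℕ<n i)) ⟩
    descends xor descends                  ≡⟨ Bool.xor-same descends ⟩
    false                                  ∎)) λ ()
    where
    open ≡-Reasoning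
    i = inverse w (g x)
    ascends = W (toℕ i) ℕ.<ᵇ W (next (toℕ i))
    descends = W (next (next (toℕ i))) ℕ.<ᵇ W (next (toℕ i))

  exc-foata : Alternating w → odd n ≡ false → exc σ ≡ ℕ.⌊ n /2⌋
  exc-foata alternating even = begin
    exc σ                                                          ≡⟨ length-filterᵇ-permute perm _ ⟩
    length (filterᵇ (λ i → lookup w i <ᵇ f (lookup w i)) (allFin n)) ≡⟨ length-filterᵇ-cong _ _ {allFin n} (λ {i} _ → ascends i) ⟩
    length (filterᵇ (odd ∘ toℕ) (allFin n))                        ≡⟨ count-odd-positions n (odd ∘ toℕ) (λ i → i) (λ _ → refl) ⟩
    ℕ.⌊ n /2⌋                                                      ∎
    where
    open ≡-Reasoning
    ascends : ∀ i → (lookup w i <ᵇ f (lookup w i)) ≡ odd (toℕ i)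
    ascends i = trans (cong₂ ℕ._<ᵇ_ (sym (valueAt-toℕ w i)) (toℕ-foata-lookup i))
      (FromAlternating.ascends-at-odd alternating even (toℕ i) (Fin.toℕ<n i))

module _ {n : ℕ} where

  foata-∈-Sym : {w : Vec (Fin n) n} → w ∈ Sym n → foata w ∈ Sym n
  foata-∈-Sym w∈ = ∈-Sym⁺ (FoataPerm.foata-permutation (∈-Sym⁻ w∈))

  foata-injectiveOn-Sym : InjectiveOn (Sym n) foata
  foata-injectiveOn-Sym w∈ w′∈ = foata-injective (∈-Sym⁻ w∈) (∈-Sym⁻ w′∈)

  foata-onto-Sym : {σ : Vec (Fin n) n} → σ ∈ Sym n → ∃[ w ] w ∈ Sym n × σ ≡ foata w
  foata-onto-Sym σ∈ = ∈-map⁻ foata (⊆-length⇒⊇ (Vec.≡-dec Fin._≟_)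
    (map⁺-injectiveOn foata-injectiveOn-Sym Sym-unique)
    (λ σ∈′ → let _ , w∈ , σ≡ = ∈-map⁻ foata σ∈′ in subst (_∈ Sym n) (sym σ≡) (foata-∈-Sym w∈))
    (ℕ.≤-reflexive (sym (List.length-map foata (Sym n)))) σ∈)

  ∈-Alt⁻ : {w : Vec (Fin n) n} → w ∈ Alt n → w ∈ Sym n × Alternating w
  ∈-Alt⁻ {w} w∈ = let w∈Sym , t = ∈-filterᵇ⁻ isAlternating (Sym n) w∈ in w∈Sym , to (T-isAlternating w) t

  ∈-Alt⁺ : {w : Vec (Fin n) n} → w ∈ Sym n → Alternating w → w ∈ Alt n
  ∈-Alt⁺ {w} w∈ alt = ∈-filterᵇ⁺ isAlternating w∈ (from (T-isAlternating w) alt)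

  module _ {w : Vec (Fin n) n} (w∈ : w ∈ Sym n) where

    private
      perm = ∈-Sym⁻ w∈
      open FoataParity perm
      open FoataCycles perm

    foata-∈-PeakValley⁻ : foata w ∈ PeakValleyDerangements n → Alternating w × odd n ≡ false
    foata-∈-PeakValley⁻ σ∈ = FromBlocks.alternating noSingleton alternate , FromBlocks.even noSingleton alternate
      where
      member = ∈-filterᵇ⁻ noCyclicDouble (Derangements n) σ∈
      noSingleton = fixedPointFree⇒noSingleton (proj₂ (∈-Derangements⁻ (proj₁ member)))
      alternate = noCyclicDouble⇒alternate (proj₂ member)

    foata-∈-PeakValley⁺ : Alternating w → odd n ≡ false → foata w ∈ PeakValleyDerangements n
    foata-∈-PeakValley⁺ alt even = ∈-filterᵇ⁺ noCyclicDouble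
      (∈-Derangements⁺ (FoataPerm.foata-permutation perm) (noSingleton⇒fixedPointFree (FromAlternating.noSingleton alt even)))
      (alternate⇒noCyclicDouble (FromAlternating.alternate alt even))

no-members⇒[] : {A : Set} {xs : List A} → (∀ {x} → x ∉ xs) → xs ≡ []
no-members⇒[] {xs = []}    _    = refl
no-members⇒[] {xs = x ∷ _} ∉xs = contradiction (here refl) ∉xs

odd-double : ∀ p → odd (2 * p) ≡ false
odd-double zero    = refl
odd-double (suc p) = trans (cong odd (ℕ.*-suc 2 p)) (odd-double p)

odd-double-pred : ∀ p → 1 ℕ.≤ p → odd (2 * p ℕ.∸ 1) ≡ true
odd-double-pred (suc p) _ = trans (cong (λ k → odd (k ℕ.∸ 1)) (ℕ.*-suc 2 p))
  (odd-suc-of-even (2 * p) (odd-double p))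

⌊double/2⌋ : ∀ p → ℕ.⌊ 2 * p /2⌋ ≡ p
⌊double/2⌋ p = sym (trans (ℕ.n≡⌊n+n/2⌋ p) (cong (λ k → ℕ.⌊ p + k /2⌋) (sym (ℕ.+-identityʳ p))))

negOnePow-square : ∀ p → negOnePow p *ℤ negOnePow p ≡ + 1
negOnePow-square zero    = refl
negOnePow-square (suc p) = begin
  - a *ℤ - a   ≡⟨ ℤ.neg-distribˡ-* a (- a) ⟨
  - (a *ℤ - a) ≡⟨ cong -_ (ℤ.neg-distribʳ-* a a) ⟨
  - - (a *ℤ a) ≡⟨ ℤ.neg-involutive (a *ℤ a) ⟩
  a *ℤ a       ≡⟨ negOnePow-square p ⟩
  + 1          ∎
  where
  open ≡-Reasoning
  a = negOnePow p

negOnePow-cancel : ∀ p m → negOnePow p *ℤ (+ m *ℤ negOnePow p) ≡ + m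
negOnePow-cancel p m = begin
  a *ℤ (+ m *ℤ a) ≡⟨ cong (a *ℤ_) (ℤ.*-comm (+ m) a) ⟩
  a *ℤ (a *ℤ + m) ≡⟨ ℤ.*-assoc a a (+ m) ⟨
  (a *ℤ a) *ℤ + m ≡⟨ cong (_*ℤ + m) (negOnePow-square p) ⟩
  + 1 *ℤ + m      ≡⟨ ℤ.*-identityˡ (+ m) ⟩
  + m             ∎
  where
  open ≡-Reasoning
  a = negOnePow p

module _ {n : ℕ} where

  ∈-PeakValley⇒∈-Sym : {σ : Vec (Fin n) n} → σ ∈ PeakValleyDerangements n → σ ∈ Sym n
  ∈-PeakValley⇒∈-Sym σ∈ = ∈-Sym⁺ (proj₁ (∈-Derangements⁻ (proj₁ (∈-filterᵇ⁻ noCyclicDouble (Derangements n) σ∈))))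

  foata-onto-PeakValley : {σ : Vec (Fin n) n} → σ ∈ PeakValleyDerangements n →
    ∃[ w ] w ∈ Sym n × σ ≡ foata w × Alternating w × odd n ≡ false
  foata-onto-PeakValley σ∈ =
    let w , w∈ , σ≡ = foata-onto-Sym (∈-PeakValley⇒∈-Sym σ∈)
    in w , w∈ , σ≡ , foata-∈-PeakValley⁻ w∈ (subst (_∈ PeakValleyDerangements n) σ≡ σ∈)

sumℤ-PeakValley-odd : ∀ n → odd n ≡ true → sumℤ (map excSign (PeakValleyDerangements n)) ≡ + 0
sumℤ-PeakValley-odd n odd-n = cong (sumℤ ∘ map excSign) (no-members⇒[] {xs = PeakValleyDerangements n} λ σ∈ →
  let _ , _ , _ , _ , even = foata-onto-PeakValley σ∈ in contradiction (trans (sym odd-n) even) λ ())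

sumℤ-PeakValley-even : ∀ p →
  sumℤ (map excSign (PeakValleyDerangements (2 * p))) ≡ + length (Alt (2 * p)) *ℤ negOnePow p
sumℤ-PeakValley-even p = begin
  sumℤ (map excSign (PeakValleyDerangements n))     ≡⟨ sumℤ-reindex excSign foata
                                                         (filterᵇ-unique isAlternating Sym-unique)
                                                         (filterᵇ-unique noCyclicDouble Derangements-unique)
                                                         (λ w∈ w′∈ → foata-injectiveOn-Sym (proj₁ (∈-Alt⁻ w∈)) (proj₁ (∈-Alt⁻ w′∈)))
                                                         into onto ⟩
  sumℤ (map (excSign ∘ foata) (Alt n))              ≡⟨ sumℤ-map-cong (Alt n) sign ⟩
  sumℤ (map (λ _ → negOnePow p) (Alt n))            ≡⟨ sumℤ-map-const (negOnePow p) (Alt n) ⟩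
  + length (Alt n) *ℤ negOnePow p                    ∎
  where
  open ≡-Reasoning
  n = 2 * p
  into : ∀ {w} → w ∈ Alt n → foata w ∈ PeakValleyDerangements n
  into w∈ = let w∈Sym , alt = ∈-Alt⁻ w∈ in foata-∈-PeakValley⁺ w∈Sym alt (odd-double p)
  onto : ∀ {σ} → σ ∈ PeakValleyDerangements n → ∃[ w ] w ∈ Alt n × σ ≡ foata w
  onto σ∈ = let w , w∈ , σ≡ , alt , _ = foata-onto-PeakValley σ∈ in w , ∈-Alt⁺ w∈ alt , σ≡
  sign : ∀ {w} → w ∈ Alt n → excSign (foata w) ≡ negOnePow p
  sign w∈ = let w∈Sym , alt = ∈-Alt⁻ w∈ in
    cong negOnePow (trans (FoataCycles.exc-foata (∈-Sym⁻ w∈Sym) alt (odd-double p)) (⌊double/2⌋ p))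

mainTheorem20 : (p : ℕ) → 1 Data.Nat.≤ p →
    (B-at-minus-one (2 * p Data.Nat.∸ 1) ≡ + 0)
    × (negOnePow p *ℤ B-at-minus-one (2 * p) ≡ + length (Alt (2 * p)))
mainTheorem20 p 1≤p =
  trans (B-at-minus-one≡sum-PeakValley (2 * p ℕ.∸ 1)) (sumℤ-PeakValley-odd (2 * p ℕ.∸ 1) (odd-double-pred p 1≤p)) ,
  trans (cong (negOnePow p *ℤ_) (trans (B-at-minus-one≡sum-PeakValley (2 * p)) (sumℤ-PeakValley-even p)))
        (negOnePow-cancel p (length (Alt (2 * p))))
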